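{- Let $k,d,\lambda$ be positive integers with $d\ge\lambda$ and $k\ge\lambda+1$. Let $j$ be an integer in $\{\lambda+1,\ldots,d-\lambda+2\}$, let $\beta=\lceil\frac{j+\lambda-1}{2}\rceil$, and let $a,r$ be integers with $a\ge0$, $r\in\{0,\ldots,j-1\}$, such that $\beta(a+1)\le k-1$ whenever $r\ge\beta$, and $(a+1)r+(\beta-r)a\le k-1$ whenever $r\le\beta-1$. Then the vertex set of the cyclic polytope in $\mathbb{R}^d$ with $(d-\lambda+1)+aj+r$ vertices has a complete Kneser $(d-\lambda)$-transversal to the convex hulls of its $k$-element subsets.
   Context: The moment curve is $\gamma(t)=(t,t^2,\ldots,t^d)$; a cyclic polytope with $n$ vertices is the convex hull of $\{\gamma(t_1),\ldots,\gamma(t_n)\}$ for reals $t_1<\cdots<t_n$ (its combinatorial type does not depend on the $t_i$). For a finite set $X\subset\mathbb{R}^d$, a $(d-\lambda)$-plane $L$ is a complete Kneser $(d-\lambda)$-transversal of $X$ if $L$ intersects $\operatorname{conv}(K)$ for every $k$-element subset $K\subseteq X$ and $L$ contains $d-\lambda+1$ points of $X$.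
   Formalization: The parameters $t_1<\cdots<t_n$ of the cyclic polytope are rational rather than real, and the ambient space, including the transversal plane, is ℚ^d in place of $\mathbb{R}^d$. -}

module Defs where

open import Data.Nat as ℕ using (ℕ; zero; suc)
open import Data.Fin as Fin using (Fin)
open import Data.Fin.Subset using (Subset; _∈_; _∉_; ∣_∣)
open import Data.Rational using (ℚ; 0ℚ; 1ℚ; _+_; _*_; _≤_; _<_)
open import Data.Product using (Σ; ∃; _×_)
open import Relation.Binary.PropositionalEquality using (_≡_)
open import Function.Definitions using (Injective)

Pt : ℕ → Set
Pt d = Fin d → ℚ

_≐_ : ∀ {d} → Pt d → Pt d → Set
x ≐ y = ∀ i → x i ≡ y i

sumFin : ∀ {m} → (Fin m → ℚ) → ℚ
sumFin {zero}  f = 0ℚ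
sumFin {suc m} f = f Fin.zero + sumFin (λ i → f (Fin.suc i))

lincomb : ∀ {m d} → (Fin m → ℚ) → (Fin m → Pt d) → Pt d
lincomb c v = λ x → sumFin (λ i → c i * v i x)

pow : ℚ → ℕ → ℚ
pow t zero    = 1ℚ
pow t (suc e) = t * pow t e

moment : (d : ℕ) → ℚ → Pt d
moment d t i = pow t (suc (Fin.toℕ i))

LinIndep : ∀ {m d} → (Fin m → Pt d) → Set
LinIndep {m} {d} v = (c : Fin m → ℚ) → lincomb c v ≐ (λ _ → 0ℚ) → ∀ i → c i ≡ 0ℚ

record Plane (m d : ℕ) : Set where
  field
    base  : Pt d
    dir   : Fin m → Pt d
    indep : LinIndep dir

_∈P_ : ∀ {m d} → Pt d → Plane m d → Set
x ∈P L = ∃ λ (c : Fin _ → ℚ) → x ≐ (λ i → Plane.base L i + lincomb c (Plane.dir L) i)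

InConv : ∀ {n d} → (Fin n → Pt d) → Subset n → Pt d → Set
InConv {n} X K y = ∃ λ (w : Fin n → ℚ) →
  (∀ i → 0ℚ ≤ w i) × (∀ i → i ∉ K → w i ≡ 0ℚ) × (sumFin w ≡ 1ℚ) × (y ≐ lincomb w X)

CompleteKneserTransversal : ∀ {n d} → (m k : ℕ) → (Fin n → Pt d) → Plane m d → Set
CompleteKneserTransversal {n} {d} m k X L =
  ((K : Subset n) → ∣ K ∣ ≡ k → ∃ λ y → y ∈P L × InConv X K y)
  × (∃ λ (f : Fin (suc m) → Fin n) → Injective _≡_ _≡_ f × (∀ i → X (f i) ∈P L))

cyclicVerts : ∀ {n} → (d : ℕ) → (Fin n → ℚ) → Fin n → Pt d
cyclicVerts d t i = moment d (t i)

StrictIncr : ∀ {n} → (Fin n → ℚ) → Set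
StrictIncr t = ∀ i j → i Fin.< j → t i < t j

module Submission where

-- The plane L is spanned by d - λ + 1 vertices of the cyclic polytope, the separators, placed so
-- that the remaining a j + r vertices fall into j gaps of sizes a + 1 (r of them) and a. For a
-- k-set K avoiding the separators, pick greedily at most one point of K per gap so that, in the
-- increasing sequence of separators and picks, all picks sit at positions of one parity. A
-- nonempty gap is only skipped when the next gap can be used, so twice the number of nonempty
-- gaps is at most j plus the number of picks; with at most λ picks, K would meet at most
-- β = ⌊(j + λ) / 2⌋ gaps and have at most a β + min(β, r) ≤ k - 1 points. So there are at least
-- λ + 1 picks, i.e. at least d + 2 points of the moment curve. Their divided-difference
-- dependence has alternating signs, hence one sign on all picks, and normalising it exhibits a
-- point of conv K that is an affine combination of separators, i.e. a point of L.

open import Defs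

module MomentCurve where

  open import Data.Nat as ℕ using (ℕ; zero; suc)
  import Data.Nat.Properties as ℕP
  open import Data.Fin as Fin using (Fin; zero; suc; toℕ)
  import Data.Fin.Properties as FinP
  open import Data.Fin.Subset using (Subset; _∈_; _∉_)
  open import Data.Fin.Subset.Properties using (_∈?_)
  open import Data.Bool.Base using (if_then_else_)
  open import Data.Rational as ℚ using (ℚ; 0ℚ; 1ℚ; _+_; _*_; _-_; -_; _≤_; _<_; 1/_)
  import Data.Rational.Properties as ℚP
  open import Data.Rational.Solver using (module +-*-Solver)
  open import Data.Product using (∃; _×_; _,_; proj₁)
  open import Data.Sum using (_⊎_; inj₁; inj₂; [_,_]′)
  open import Data.Empty using (⊥-elim)
  open import Relation.Nullary using (Dec; yes; no; does)
  open import Relation.Binary.PropositionalEquality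
  open import Algebra.Bundles using (Ring)
  open import Algebra.Properties.Semiring.Sum (Ring.semiring ℚP.+-*-ring)
    using (sum; sum-replicate-zero; ∑-distrib-+; ∑-comm; *-distribˡ-sum)
  open import Algebra.Properties.Group ℚP.+-0-group using (inverseʳ-unique; x∙y⁻¹≈ε⇒x≈y)
  open import Data.Vec.Functional using (tail)
  open import Data.Parity.Base as ℙ using (Parity; 0ℙ; 1ℙ)
  import Data.Parity.Properties as ℙP
  open import Data.Nat.Base using (parity)
  open +-*-Solver

  sumFin≡sum : ∀ {m} (f : Fin m → ℚ) → sumFin f ≡ sum f
  sumFin≡sum {zero}  f = refl
  sumFin≡sum {suc m} f = cong (f zero +_) (sumFin≡sum (λ i → f (suc i)))

  sumFin-cong : ∀ {m} {f g : Fin m → ℚ} → (∀ i → f i ≡ g i) → sumFin f ≡ sumFin g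
  sumFin-cong {zero}  f≗g = refl
  sumFin-cong {suc m} f≗g = cong₂ _+_ (f≗g zero) (sumFin-cong (λ i → f≗g (suc i)))

  sumFin-zero : ∀ m → sumFin {m} (λ _ → 0ℚ) ≡ 0ℚ
  sumFin-zero m = trans (sumFin≡sum {m} _) (sum-replicate-zero m)

  sumFin-+ : ∀ {m} (f g : Fin m → ℚ) → sumFin (λ i → f i + g i) ≡ sumFin f + sumFin g
  sumFin-+ f g rewrite sumFin≡sum (λ i → f i + g i) | sumFin≡sum f | sumFin≡sum g = ∑-distrib-+ f g

  sumFin-*ˡ : ∀ {m} (c : ℚ) (f : Fin m → ℚ) → sumFin (λ i → c * f i) ≡ c * sumFin f
  sumFin-*ˡ c f rewrite sumFin≡sum (λ i → c * f i) | sumFin≡sum f = sym (*-distribˡ-sum c f)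

  sumFin-neg : ∀ {m} (f : Fin m → ℚ) → sumFin (λ i → - f i) ≡ - sumFin f
  sumFin-neg {m} f = inverseʳ-unique (sumFin f) _ (begin
    sumFin f + sumFin (λ i → - f i) ≡⟨ sumFin-+ f (λ i → - f i) ⟨
    sumFin (λ i → f i - f i)        ≡⟨ sumFin-cong {m} (λ i → ℚP.+-inverseʳ (f i)) ⟩
    sumFin {m} (λ _ → 0ℚ)           ≡⟨ sumFin-zero m ⟩
    0ℚ                              ∎)
    where open ≡-Reasoning

  private
    sumFin²≡sum² : ∀ {m M} (h : Fin m → Fin M → ℚ) → sumFin (λ i → sumFin (h i)) ≡ sum (λ i → sum (h i))
    sumFin²≡sum² h = trans (sumFin-cong (λ i → sumFin≡sum (h i))) (sumFin≡sum (λ i → sum (h i)))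

  sumFin-comm : ∀ {m M} (h : Fin m → Fin M → ℚ) →
    sumFin (λ i → sumFin (h i)) ≡ sumFin (λ q → sumFin (λ i → h i q))
  sumFin-comm h = trans (sumFin²≡sum² h) (trans (∑-comm h) (sym (sumFin²≡sum² (λ q i → h i q))))

  δ : ∀ {n} → Fin n → Fin n → ℚ
  δ a i = if does (a Fin.≟ i) then 1ℚ else 0ℚ

  sumFin-δ : ∀ {n} (a : Fin n) (F : Fin n → ℚ) → sumFin (λ i → δ a i * F i) ≡ F a
  sumFin-δ {suc n} zero F = begin
    1ℚ * F zero + sumFin (λ i → 0ℚ * F (suc i))
      ≡⟨ cong₂ _+_ (ℚP.*-identityˡ (F zero)) (sumFin-cong {n} (λ i → ℚP.*-zeroˡ (F (suc i)))) ⟩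
    F zero + sumFin {n} (λ _ → 0ℚ)
      ≡⟨ cong (F zero +_) (sumFin-zero n) ⟩
    F zero + 0ℚ
      ≡⟨ ℚP.+-identityʳ _ ⟩
    F zero ∎
    where open ≡-Reasoning
  sumFin-δ {suc n} (suc a) F =
    trans (cong₂ _+_ (ℚP.*-zeroˡ (F zero)) (sumFin-δ a (λ i → F (suc i)))) (ℚP.+-identityˡ (F (suc a)))

  sumFin-nonneg : ∀ {m} (f : Fin m → ℚ) → (∀ i → 0ℚ ≤ f i) → 0ℚ ≤ sumFin f
  sumFin-nonneg {zero}  f f≥0 = ℚP.≤-refl
  sumFin-nonneg {suc m} f f≥0 =
    ℚP.+-mono-≤ (f≥0 zero) (sumFin-nonneg (λ i → f (suc i)) (λ i → f≥0 (suc i)))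

  sumFin-pos : ∀ {m} (f : Fin m → ℚ) → (∀ i → 0ℚ ≤ f i) → ∀ q → 0ℚ < f q → 0ℚ < sumFin f
  sumFin-pos {suc m} f f≥0 zero fq>0 =
    ℚP.+-mono-<-≤ fq>0 (sumFin-nonneg (λ i → f (suc i)) (λ i → f≥0 (suc i)))
  sumFin-pos {suc m} f f≥0 (suc q) fq>0 =
    ℚP.+-mono-≤-< (f≥0 zero) (sumFin-pos (λ i → f (suc i)) (λ i → f≥0 (suc i)) q fq>0)

  -- A total inverse with 0 ⁻¹ = 0; it is only ever applied to differences of distinct nodes.
  _⁻¹ : ℚ → ℚ
  x ⁻¹ with x ℚP.≟ 0ℚ
  ... | yes _   = 0ℚ
  ... | no x≢0 = (1/ x) {{ℚ.≢-nonZero x≢0}}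

  ⁻¹-inverseʳ : ∀ {x} → x ≢ 0ℚ → x * x ⁻¹ ≡ 1ℚ
  ⁻¹-inverseʳ {x} x≢0 with x ℚP.≟ 0ℚ
  ... | yes x≡0 = ⊥-elim (x≢0 x≡0)
  ... | no x≢0′ = ℚP.*-inverseʳ x {{ℚ.≢-nonZero x≢0′}}

  ⁻¹-pos : ∀ {x} → 0ℚ < x → 0ℚ < x ⁻¹
  ⁻¹-pos {x} x>0 with x ℚP.≟ 0ℚ
  ... | yes x≡0 = ⊥-elim (ℚP.<⇒≢ x>0 (sym x≡0))
  ... | no x≢0  = ℚP.positive⁻¹ _ {{ℚP.1/pos⇒pos x {{ℚ.positive x>0}}}}

  *-pos : ∀ {x y} → 0ℚ < x → 0ℚ < y → 0ℚ < x * y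
  *-pos {x} {y} x>0 y>0 = ℚP.positive⁻¹ _ {{ℚP.pos*pos⇒pos x {{ℚ.positive x>0}} y {{ℚ.positive y>0}}}}

  *-nonneg : ∀ {x y} → 0ℚ ≤ x → 0ℚ ≤ y → 0ℚ ≤ x * y
  *-nonneg {x} {y} x≥0 y≥0 =
    ℚP.nonNegative⁻¹ _ {{ℚP.nonNeg*nonNeg⇒nonNeg x {{ℚ.nonNegative x≥0}} y {{ℚ.nonNegative y≥0}}}}

  x<y⇒0<y-x : ∀ {x y} → x < y → 0ℚ < y - x
  x<y⇒0<y-x {x} {y} x<y = subst (_< y - x) (ℚP.+-inverseʳ x) (ℚP.+-monoˡ-< (- x) x<y)

  x<y⇒y-x≢0 : ∀ {x y} → x < y → y - x ≢ 0ℚ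
  x<y⇒y-x≢0 x<y y-x≡0 = ℚP.<⇒≢ (x<y⇒0<y-x x<y) (sym y-x≡0)

  x*y≡0⇒x≡0 : ∀ {x y} → y ≢ 0ℚ → x * y ≡ 0ℚ → x ≡ 0ℚ
  x*y≡0⇒x≡0 {x} {y} y≢0 xy≡0 = begin
    x              ≡⟨ ℚP.*-identityʳ x ⟨
    x * 1ℚ         ≡⟨ cong (x *_) (⁻¹-inverseʳ y≢0) ⟨
    x * (y * y ⁻¹) ≡⟨ ℚP.*-assoc x y (y ⁻¹) ⟨
    x * y * y ⁻¹   ≡⟨ cong (_* y ⁻¹) xy≡0 ⟩
    0ℚ * y ⁻¹      ≡⟨ ℚP.*-zeroˡ (y ⁻¹) ⟩
    0ℚ             ∎
    where open ≡-Reasoning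

  powerSum : ∀ {M} → (Fin M → ℚ) → (Fin M → ℚ) → ℕ → ℚ
  powerSum u e p = sumFin (λ s → e s * pow (u s) p)

  powerSum-*ˡ : ∀ {M} (u e : Fin M → ℚ) c p → powerSum u (λ s → c * e s) p ≡ c * powerSum u e p
  powerSum-*ˡ u e c p =
    trans (sumFin-cong (λ s → ℚP.*-assoc c (e s) (pow (u s) p))) (sumFin-*ˡ c (λ s → e s * pow (u s) p))

  powerSum-shift : ∀ {M} (u e : Fin M → ℚ) c p →
    sumFin (λ s → e s * (u s - c) * pow (u s) p) ≡ powerSum u e (suc p) - c * powerSum u e p
  powerSum-shift u e c p = begin
    sumFin (λ s → e s * (u s - c) * pow (u s) p)
      ≡⟨ sumFin-cong (λ s → expand (e s) (u s) (pow (u s) p) c) ⟩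
    sumFin (λ s → e s * pow (u s) (suc p) + - (c * (e s * pow (u s) p)))
      ≡⟨ sumFin-+ (λ s → e s * pow (u s) (suc p)) (λ s → - (c * (e s * pow (u s) p))) ⟩
    powerSum u e (suc p) + sumFin (λ s → - (c * (e s * pow (u s) p)))
      ≡⟨ cong (powerSum u e (suc p) +_) (sumFin-neg (λ s → c * (e s * pow (u s) p))) ⟩
    powerSum u e (suc p) - sumFin (λ s → c * (e s * pow (u s) p))
      ≡⟨ cong (λ z → powerSum u e (suc p) - z) (sumFin-*ˡ c (λ s → e s * pow (u s) p)) ⟩
    powerSum u e (suc p) - c * powerSum u e p ∎
    where
    open ≡-Reasoning
    expand : ∀ a x P c → a * (x - c) * P ≡ a * (x * P) + - (c * (a * P))
    expand = solve 4 (λ a x P c → a :* (x :- c) :* P := a :* (x :* P) :+ :- (c :* (a :* P))) refl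

  powerSum-tilt : ∀ {M} (u e : Fin (suc M) → ℚ) p →
    powerSum (tail u) (λ s → e (suc s) * (u (suc s) - u zero)) p
      ≡ powerSum u e (suc p) - u zero * powerSum u e p
  powerSum-tilt u e p = trans (sym headVanishes) (powerSum-shift u e u₀ p)
    where
    u₀ tailSum : ℚ
    u₀ = u zero
    tailSum = sumFin (λ s → e (suc s) * (u (suc s) - u₀) * pow (u (suc s)) p)
    headVanishes : e zero * (u₀ - u₀) * pow u₀ p + tailSum ≡ tailSum
    headVanishes = solve 4 (λ e u P T → e :* (u :- u) :* P :+ T := T) refl (e zero) u₀ (pow u₀ p) tailSum

  tail↑ : ∀ {M} {u : Fin (suc M) → ℚ} → StrictIncr u → StrictIncr (tail u)
  tail↑ u↑ i j i<j = u↑ (suc i) (suc j) (ℕ.s≤s i<j)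

  head<tail : ∀ {M} {u : Fin (suc M) → ℚ} → StrictIncr u → ∀ s → u zero < u (suc s)
  head<tail u↑ s = u↑ zero (suc s) (ℕ.s≤s ℕ.z≤n)

  -- Tilting the weights by u s - u₀ kills the first one and lowers the degree of the vanishing power sums.
  powerSums≡0⇒weights≡0 : ∀ {M} D (u e : Fin M → ℚ) → StrictIncr u → M ℕ.≤ suc D →
    (∀ p → p ℕ.≤ D → powerSum u e p ≡ 0ℚ) → ∀ s → e s ≡ 0ℚ
  private
    powerSums≡0⇒tailWeights≡0 : ∀ {M} D (u e : Fin (suc M) → ℚ) → StrictIncr u → suc M ℕ.≤ suc D →
      (∀ p → p ℕ.≤ D → powerSum u e p ≡ 0ℚ) → ∀ s → e (suc s) ≡ 0ℚ

  powerSums≡0⇒weights≡0 {suc M} D u e u↑ M≤ ps≡0 zero = begin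
    e zero           ≡⟨ ℚP.*-identityʳ _ ⟨
    e zero * 1ℚ      ≡⟨ ℚP.+-identityʳ _ ⟨
    e zero * 1ℚ + 0ℚ ≡⟨ cong (e zero * 1ℚ +_) tail≡0 ⟨
    powerSum u e 0   ≡⟨ ps≡0 0 ℕ.z≤n ⟩
    0ℚ               ∎
    where
    open ≡-Reasoning
    tail≡0 : sumFin (λ s → e (suc s) * 1ℚ) ≡ 0ℚ
    tail≡0 = trans (sumFin-cong {M} (λ s → cong (_* 1ℚ) (powerSums≡0⇒tailWeights≡0 D u e u↑ M≤ ps≡0 s)))
                   (sumFin-zero M)
  powerSums≡0⇒weights≡0 {suc M} D u e u↑ M≤ ps≡0 (suc s) = powerSums≡0⇒tailWeights≡0 D u e u↑ M≤ ps≡0 s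

  powerSums≡0⇒tailWeights≡0 {suc M} zero    u e u↑ (ℕ.s≤s ()) ps≡0 s
  powerSums≡0⇒tailWeights≡0 {suc M} (suc D) u e u↑ (ℕ.s≤s M≤) ps≡0 s =
    x*y≡0⇒x≡0 (x<y⇒y-x≢0 (head<tail u↑ s))
      (powerSums≡0⇒weights≡0 D (tail u) e⁺ (tail↑ u↑) M≤ tilted≡0 s)
    where
    e⁺ : Fin (suc M) → ℚ
    e⁺ s = e (suc s) * (u (suc s) - u zero)
    tilted≡0 : ∀ p → p ℕ.≤ D → powerSum (tail u) e⁺ p ≡ 0ℚ
    tilted≡0 p p≤D = begin
      powerSum (tail u) e⁺ p
        ≡⟨ powerSum-tilt u e p ⟩
      powerSum u e (suc p) - u zero * powerSum u e p
        ≡⟨ cong₂ (λ x y → x - u zero * y) (ps≡0 (suc p) (ℕ.s≤s p≤D)) (ps≡0 p (ℕP.m≤n⇒m≤1+n p≤D)) ⟩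
      0ℚ - u zero * 0ℚ
        ≡⟨ cong (λ z → 0ℚ - z) (ℚP.*-zeroʳ (u zero)) ⟩
      0ℚ ∎
      where open ≡-Reasoning

  -- ddWeight N u s = 1 / ∏_{t ≠ s} (u s - u t): the weights of the divided difference
  -- f[u₀, …, u_N] = Σ_s ddWeight N u s * f (u s), computed by recursion on the first node.
  -- poleSum N u c is the divided difference of x ↦ 1 / (x - c).
  ddWeight : ∀ N → (Fin (suc N) → ℚ) → Fin (suc N) → ℚ
  poleSum : ∀ N → (Fin (suc N) → ℚ) → ℚ → ℚ

  ddWeight zero    u _       = 1ℚ
  ddWeight (suc N) u zero    = - poleSum N (tail u) (u zero)
  ddWeight (suc N) u (suc s) = ddWeight N (tail u) s * (u (suc s) - u zero) ⁻¹

  poleSum N u c = sumFin (λ s → ddWeight N u s * (u s - c) ⁻¹)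

  powerSum-ddWeight : ∀ N (u : Fin (suc N) → ℚ) → StrictIncr u →
    ∀ p → p ℕ.< N → powerSum u (ddWeight N u) p ≡ 0ℚ
  powerSum-ddWeight (suc N) u u↑ = vanish
    where
    open ≡-Reasoning
    w : Fin (suc (suc N)) → ℚ
    w = ddWeight (suc N) u
    u₀ : ℚ
    u₀ = u zero
    untilt : ∀ s → w (suc s) * (u (suc s) - u₀) ≡ ddWeight N (tail u) s
    untilt s = begin
      ddWeight N (tail u) s * D ⁻¹ * D
        ≡⟨ ℚP.*-assoc (ddWeight N (tail u) s) (D ⁻¹) D ⟩
      ddWeight N (tail u) s * (D ⁻¹ * D)
        ≡⟨ cong (ddWeight N (tail u) s *_) (trans (ℚP.*-comm (D ⁻¹) D) (⁻¹-inverseʳ D≢0)) ⟩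
      ddWeight N (tail u) s * 1ℚ
        ≡⟨ ℚP.*-identityʳ _ ⟩
      ddWeight N (tail u) s ∎
      where
      D : ℚ
      D = u (suc s) - u₀
      D≢0 : D ≢ 0ℚ
      D≢0 = x<y⇒y-x≢0 (head<tail u↑ s)
    step : ∀ p → p ℕ.< N → powerSum u w (suc p) ≡ u₀ * powerSum u w p
    step p p<N = x∙y⁻¹≈ε⇒x≈y _ _ (begin
      powerSum u w (suc p) - u₀ * powerSum u w p
        ≡⟨ powerSum-tilt u w p ⟨
      powerSum (tail u) (λ s → w (suc s) * (u (suc s) - u₀)) p
        ≡⟨ sumFin-cong (λ s → cong (_* pow (u (suc s)) p) (untilt s)) ⟩
      powerSum (tail u) (ddWeight N (tail u)) p
        ≡⟨ powerSum-ddWeight N (tail u) (tail↑ u↑) p p<N ⟩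
      0ℚ ∎)
    total≡0 : powerSum u w 0 ≡ 0ℚ
    total≡0 = begin
      - P * 1ℚ + sumFin (λ s → w (suc s) * 1ℚ)
        ≡⟨ cong₂ _+_ (ℚP.*-identityʳ (- P)) (sumFin-cong (λ s → ℚP.*-identityʳ (w (suc s)))) ⟩
      - P + P
        ≡⟨ ℚP.+-inverseˡ P ⟩
      0ℚ ∎
      where
      P : ℚ
      P = poleSum N (tail u) u₀
    vanish : ∀ p → p ℕ.< suc N → powerSum u w p ≡ 0ℚ
    vanish zero    _           = total≡0
    vanish (suc p) (ℕ.s≤s p<N) = begin
      powerSum u w (suc p) ≡⟨ step p p<N ⟩
      u₀ * powerSum u w p  ≡⟨ cong (u₀ *_) (vanish p (ℕP.m≤n⇒m≤1+n p<N)) ⟩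
      u₀ * 0ℚ              ≡⟨ ℚP.*-zeroʳ u₀ ⟩
      0ℚ                   ∎

  partialFraction : ∀ x y c → x - y ≢ 0ℚ → x - c ≢ 0ℚ → y - c ≢ 0ℚ →
    (x - y) ⁻¹ * (x - c) ⁻¹ ≡ (y - c) ⁻¹ * ((x - y) ⁻¹ - (x - c) ⁻¹)
  partialFraction x y c x-y≢0 x-c≢0 y-c≢0 = sym (begin
    C * (A - B)
      ≡⟨ cong (C *_) AB[y-c]≡A-B ⟨
    C * (A * B * (y - c))
      ≡⟨ solve 6 (λ A B C x y c → C :* (A :* B :* (y :- c)) := A :* B :* ((y :- c) :* C)) refl A B C x y c ⟩
    A * B * ((y - c) * C)
      ≡⟨ cong (A * B *_) (⁻¹-inverseʳ y-c≢0) ⟩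
    A * B * 1ℚ
      ≡⟨ ℚP.*-identityʳ (A * B) ⟩
    A * B ∎)
    where
    open ≡-Reasoning
    A B C : ℚ
    A = (x - y) ⁻¹
    B = (x - c) ⁻¹
    C = (y - c) ⁻¹
    AB[y-c]≡A-B : A * B * (y - c) ≡ A - B
    AB[y-c]≡A-B = begin
      A * B * (y - c)
        ≡⟨ solve 5 (λ A B x y c → A :* B :* (y :- c) := A :* ((x :- c) :* B) :- B :* ((x :- y) :* A)) refl A B x y c ⟩
      A * ((x - c) * B) - B * ((x - y) * A)
        ≡⟨ cong₂ (λ p q → A * p - B * q) (⁻¹-inverseʳ x-c≢0) (⁻¹-inverseʳ x-y≢0) ⟩
      A * 1ℚ - B * 1ℚ
        ≡⟨ cong₂ _-_ (ℚP.*-identityʳ A) (ℚP.*-identityʳ B) ⟩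
      A - B ∎

  poleSum-suc : ∀ N (u : Fin (suc (suc N)) → ℚ) c → StrictIncr u → c < u zero →
    poleSum (suc N) u c ≡ - ((u zero - c) ⁻¹ * poleSum N (tail u) c)
  poleSum-suc N u c u↑ c<u₀ = begin
    - P₀ * I + sumFin (λ s → v s * D s ⁻¹ * E s ⁻¹)
      ≡⟨ cong (- P₀ * I +_) (sumFin-cong split) ⟩
    - P₀ * I + sumFin (λ s → I * (v s * D s ⁻¹) + - (I * (v s * E s ⁻¹)))
      ≡⟨ cong (- P₀ * I +_) (sumFin-+ (λ s → I * (v s * D s ⁻¹)) (λ s → - (I * (v s * E s ⁻¹)))) ⟩
    - P₀ * I + (sumFin (λ s → I * (v s * D s ⁻¹)) + sumFin (λ s → - (I * (v s * E s ⁻¹))))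
      ≡⟨ cong₂ (λ p q → - P₀ * I + (p + q)) (sumFin-*ˡ I (λ s → v s * D s ⁻¹))
           (trans (sumFin-neg (λ s → I * (v s * E s ⁻¹))) (cong -_ (sumFin-*ˡ I (λ s → v s * E s ⁻¹)))) ⟩
    - P₀ * I + (I * P₀ + - (I * Pc))
      ≡⟨ solve 3 (λ P₀ I Pc → :- P₀ :* I :+ (I :* P₀ :+ :- (I :* Pc)) := :- (I :* Pc)) refl P₀ I Pc ⟩
    - (I * Pc) ∎
    where
    open ≡-Reasoning
    v D E : Fin (suc N) → ℚ
    v = ddWeight N (tail u)
    D s = u (suc s) - u zero
    E s = u (suc s) - c
    I P₀ Pc : ℚ
    I = (u zero - c) ⁻¹
    P₀ = poleSum N (tail u) (u zero)
    Pc = poleSum N (tail u) c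
    split : ∀ s → v s * D s ⁻¹ * E s ⁻¹ ≡ I * (v s * D s ⁻¹) + - (I * (v s * E s ⁻¹))
    split s = begin
      v s * D s ⁻¹ * E s ⁻¹
        ≡⟨ ℚP.*-assoc (v s) (D s ⁻¹) (E s ⁻¹) ⟩
      v s * (D s ⁻¹ * E s ⁻¹)
        ≡⟨ cong (v s *_) (partialFraction (u (suc s)) (u zero) c D≢0 E≢0 (x<y⇒y-x≢0 c<u₀)) ⟩
      v s * (I * (D s ⁻¹ - E s ⁻¹))
        ≡⟨ solve 4 (λ v I d e → v :* (I :* (d :- e)) := I :* (v :* d) :+ :- (I :* (v :* e)))
             refl (v s) I (D s ⁻¹) (E s ⁻¹) ⟩
      I * (v s * D s ⁻¹) + - (I * (v s * E s ⁻¹)) ∎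
      where
      D≢0 : D s ≢ 0ℚ
      D≢0 = x<y⇒y-x≢0 (head<tail u↑ s)
      E≢0 : E s ≢ 0ℚ
      E≢0 = x<y⇒y-x≢0 (ℚP.<-trans c<u₀ (head<tail u↑ s))

  sign : Parity → ℚ
  sign 0ℙ = 1ℚ
  sign 1ℙ = - 1ℚ

  sign-suc : ∀ n → sign (parity (suc n)) ≡ - sign (parity n)
  sign-suc zero          = refl
  sign-suc (suc zero)    = refl
  sign-suc (suc (suc n)) = sign-suc n

  sign-+ : ∀ m n → sign (parity (m ℕ.+ n)) ≡ sign (parity m) * sign (parity n)
  sign-+ m n rewrite ℙP.+-homo-+ m n = sign-homo (parity m) (parity n)
    where
    sign-homo : ∀ p q → sign (p ℙ.+ q) ≡ sign p * sign q
    sign-homo 0ℙ 0ℙ = refl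
    sign-homo 0ℙ 1ℙ = refl
    sign-homo 1ℙ 0ℙ = refl
    sign-homo 1ℙ 1ℙ = refl

  poleSum-sign : ∀ N (u : Fin (suc N) → ℚ) c → StrictIncr u → c < u zero →
    0ℚ < sign (parity N) * poleSum N u c
  poleSum-sign zero u c u↑ c<u₀ =
    subst (0ℚ <_) (sym (solve 1 (λ I → con 1ℚ :* (con 1ℚ :* I :+ con 0ℚ) := I) refl ((u zero - c) ⁻¹)))
      (⁻¹-pos (x<y⇒0<y-x c<u₀))
  poleSum-sign (suc N) u c u↑ c<u₀ = subst (0ℚ <_) (sym rearranged)
    (*-pos (⁻¹-pos (x<y⇒0<y-x c<u₀))
           (poleSum-sign N (tail u) c (tail↑ u↑) (ℚP.<-trans c<u₀ (head<tail u↑ zero))))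
    where
    σ I P : ℚ
    σ = sign (parity N)
    I = (u zero - c) ⁻¹
    P = poleSum N (tail u) c
    rearranged : sign (parity (suc N)) * poleSum (suc N) u c ≡ I * (σ * P)
    rearranged = trans (cong₂ _*_ (sign-suc N) (poleSum-suc N u c u↑ c<u₀))
                   (solve 3 (λ σ I P → :- σ :* :- (I :* P) := I :* (σ :* P)) refl σ I P)

  ddWeight-sign : ∀ N (u : Fin (suc N) → ℚ) → StrictIncr u → ∀ s →
    0ℚ < sign (parity (N ℕ.+ toℕ s)) * ddWeight N u s
  ddWeight-sign zero    u u↑ zero = ℚP.positive⁻¹ 1ℚ
  ddWeight-sign (suc N) u u↑ zero rewrite ℕP.+-identityʳ N =
    subst (0ℚ <_) (sym rearranged) (poleSum-sign N (tail u) (u zero) (tail↑ u↑) (head<tail u↑ zero))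
    where
    σ P : ℚ
    σ = sign (parity N)
    P = poleSum N (tail u) (u zero)
    rearranged : sign (parity (suc N)) * ddWeight (suc N) u zero ≡ σ * P
    rearranged = trans (cong (_* ddWeight (suc N) u zero) (sign-suc N)) (solve 2 (λ σ P → :- σ :* :- P := σ :* P) refl σ P)
  ddWeight-sign (suc N) u u↑ (suc s) rewrite ℕP.+-suc N (toℕ s) =
    subst (0ℚ <_) (ℚP.*-assoc (sign (parity (N ℕ.+ toℕ s))) (ddWeight N (tail u) s) _)
      (*-pos (ddWeight-sign N (tail u) (tail↑ u↑) s) (⁻¹-pos (x<y⇒0<y-x (head<tail u↑ s))))

  -- The divided-difference weights alternate in sign, so a signed copy is positive at every position of parity P.
  alternatingDependence : ∀ {N d} (u : Fin (suc N) → ℚ) → StrictIncr u → d ℕ.< N → (P : Parity) →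
    ∃ λ e → sumFin e ≡ 0ℚ × lincomb e (λ q → moment d (u q)) ≐ (λ _ → 0ℚ)
          × (∀ q → parity (toℕ q) ≡ P → 0ℚ < e q)
  alternatingDependence {N} {d} u u↑ d<N P = e , sum≡0 , lincomb≡0 , e-pos
    where
    open ≡-Reasoning
    σ : ℚ
    σ = sign (parity N) * sign P
    w e : Fin (suc N) → ℚ
    w = ddWeight N u
    e q = σ * w q
    powerSum≡0 : ∀ p → p ℕ.≤ d → powerSum u e p ≡ 0ℚ
    powerSum≡0 p p≤d = begin
      powerSum u e p     ≡⟨ powerSum-*ˡ u w σ p ⟩
      σ * powerSum u w p ≡⟨ cong (σ *_) (powerSum-ddWeight N u u↑ p (ℕP.≤-<-trans p≤d d<N)) ⟩
      σ * 0ℚ             ≡⟨ ℚP.*-zeroʳ σ ⟩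
      0ℚ                 ∎
    sum≡0 : sumFin e ≡ 0ℚ
    sum≡0 = trans (sumFin-cong (λ q → sym (ℚP.*-identityʳ (e q)))) (powerSum≡0 0 ℕ.z≤n)
    lincomb≡0 : lincomb e (λ q → moment d (u q)) ≐ (λ _ → 0ℚ)
    lincomb≡0 x = powerSum≡0 (suc (toℕ x)) (FinP.toℕ<n x)
    e-pos : ∀ q → parity (toℕ q) ≡ P → 0ℚ < e q
    e-pos q refl = subst (λ z → 0ℚ < z * w q) (sign-+ N (toℕ q)) (ddWeight-sign N u u↑ q)

  ∈P-resp : ∀ {m d} {L : Plane m d} {x y : Pt d} → x ≐ y → y ∈P L → x ∈P L
  ∈P-resp x≐y (c , y≐) = c , λ i → trans (x≐y i) (y≐ i)

  affineSpan : ∀ {m d} (p : Fin (suc m) → Pt d) → LinIndep (λ r x → p (suc r) x - p zero x) → Plane m d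
  affineSpan p indep = record { base = p zero ; dir = λ r x → p (suc r) x - p zero x ; indep = indep }

  affineSpan-∋ : ∀ {m d} (p : Fin (suc m) → Pt d) indep s → p s ∈P affineSpan p indep
  affineSpan-∋ {m} p indep zero = (λ _ → 0ℚ) , λ x → sym (begin
    p zero x + sumFin (λ r → 0ℚ * (p (suc r) x - p zero x))
      ≡⟨ cong (p zero x +_) (sumFin-cong {m} (λ r → ℚP.*-zeroˡ (p (suc r) x - p zero x))) ⟩
    p zero x + sumFin {m} (λ _ → 0ℚ)
      ≡⟨ cong (p zero x +_) (sumFin-zero m) ⟩
    p zero x + 0ℚ
      ≡⟨ ℚP.+-identityʳ _ ⟩
    p zero x ∎)
    where open ≡-Reasoning
  affineSpan-∋ p indep (suc s) = δ s , λ x → sym (begin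
    p zero x + sumFin (λ r → δ s r * (p (suc r) x - p zero x))
      ≡⟨ cong (p zero x +_) (sumFin-δ s (λ r → p (suc r) x - p zero x)) ⟩
    p zero x + (p (suc s) x - p zero x)
      ≡⟨ solve 2 (λ a b → a :+ (b :- a) := b) refl (p zero x) (p (suc s) x) ⟩
    p (suc s) x ∎)
    where open ≡-Reasoning

  affineCombination-∈P : ∀ {M m d} (L : Plane m d) (pts : Fin M → Pt d) (a : Fin M → ℚ) →
    (∀ q → a q ≡ 0ℚ ⊎ pts q ∈P L) → sumFin a ≡ 1ℚ → lincomb a pts ∈P L
  affineCombination-∈P {M} {m} L pts a a≡0⊎∈L Σa≡1 = (λ r → sumFin (λ q → a q * C q r)) , combination
    where
    open Plane L
    open ≡-Reasoning
    C : Fin M → Fin m → ℚ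
    C q = [ (λ _ _ → 0ℚ) , proj₁ ]′ (a≡0⊎∈L q)
    scaled : ∀ q x → a q * pts q x ≡ a q * base x + sumFin (λ r → a q * C q r * dir r x)
    scaled q x with a≡0⊎∈L q
    ... | inj₁ a≡0 rewrite a≡0 = begin
      0ℚ * pts q x
        ≡⟨ ℚP.*-zeroˡ (pts q x) ⟩
      0ℚ + 0ℚ
        ≡⟨ cong₂ _+_ (ℚP.*-zeroˡ (base x)) (trans (sumFin-cong (λ r → ℚP.*-zeroˡ (dir r x))) (sumFin-zero m)) ⟨
      0ℚ * base x + sumFin (λ r → 0ℚ * 0ℚ * dir r x) ∎
    ... | inj₂ (c , pts≐) = begin
      a q * pts q x
        ≡⟨ cong (a q *_) (pts≐ x) ⟩
      a q * (base x + sumFin (λ r → c r * dir r x))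
        ≡⟨ ℚP.*-distribˡ-+ (a q) (base x) _ ⟩
      a q * base x + a q * sumFin (λ r → c r * dir r x)
        ≡⟨ cong (a q * base x +_) (sumFin-*ˡ (a q) (λ r → c r * dir r x)) ⟨
      a q * base x + sumFin (λ r → a q * (c r * dir r x))
        ≡⟨ cong (a q * base x +_) (sumFin-cong (λ r → ℚP.*-assoc (a q) (c r) (dir r x))) ⟨
      a q * base x + sumFin (λ r → a q * c r * dir r x) ∎
    combination : lincomb a pts ≐ (λ x → base x + lincomb (λ r → sumFin (λ q → a q * C q r)) dir x)
    combination x = begin
      sumFin (λ q → a q * pts q x)
        ≡⟨ sumFin-cong (λ q → scaled q x) ⟩
      sumFin (λ q → a q * base x + sumFin (λ r → a q * C q r * dir r x))
        ≡⟨ sumFin-+ (λ q → a q * base x) (λ q → sumFin (λ r → a q * C q r * dir r x)) ⟩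
      sumFin (λ q → a q * base x) + sumFin (λ q → sumFin (λ r → a q * C q r * dir r x))
        ≡⟨ cong₂ _+_ base-part (sumFin-comm (λ q r → a q * C q r * dir r x)) ⟩
      base x + sumFin (λ r → sumFin (λ q → a q * C q r * dir r x))
        ≡⟨ cong (base x +_) (sumFin-cong (λ r → dir-part r)) ⟩
      base x + sumFin (λ r → sumFin (λ q → a q * C q r) * dir r x) ∎
      where
      base-part : sumFin (λ q → a q * base x) ≡ base x
      base-part = begin
        sumFin (λ q → a q * base x) ≡⟨ sumFin-cong (λ q → ℚP.*-comm (a q) (base x)) ⟩
        sumFin (λ q → base x * a q) ≡⟨ sumFin-*ˡ (base x) a ⟩
        base x * sumFin a           ≡⟨ cong (base x *_) Σa≡1 ⟩
        base x * 1ℚ                 ≡⟨ ℚP.*-identityʳ (base x) ⟩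
        base x                      ∎
      dir-part : ∀ r → sumFin (λ q → a q * C q r * dir r x) ≡ sumFin (λ q → a q * C q r) * dir r x
      dir-part r = begin
        sumFin (λ q → a q * C q r * dir r x)   ≡⟨ sumFin-cong (λ q → ℚP.*-comm (a q * C q r) (dir r x)) ⟩
        sumFin (λ q → dir r x * (a q * C q r)) ≡⟨ sumFin-*ˡ (dir r x) (λ q → a q * C q r) ⟩
        dir r x * sumFin (λ q → a q * C q r)   ≡⟨ ℚP.*-comm (dir r x) _ ⟩
        sumFin (λ q → a q * C q r) * dir r x   ∎

  δ-nonneg : ∀ {n} (a i : Fin n) → 0ℚ ≤ δ a i
  δ-nonneg a i with a Fin.≟ i
  ... | yes _ = ℚP.<⇒≤ (ℚP.positive⁻¹ 1ℚ)
  ... | no _  = ℚP.≤-refl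

  InConv-reindex : ∀ {M n d} (X : Fin n → Pt d) (K : Subset n) (h : Fin M → Fin n) (v : Fin M → ℚ) →
    (∀ q → 0ℚ ≤ v q) → (∀ q → h q ∉ K → v q ≡ 0ℚ) → sumFin v ≡ 1ℚ →
    InConv X K (lincomb v (λ q → X (h q)))
  InConv-reindex {M} {n} X K h v v≥0 v≡0 Σv≡1 = w , w≥0 , w≡0 , Σw≡1 , same-point
    where
    open ≡-Reasoning
    w : Fin n → ℚ
    w i = sumFin (λ q → δ (h q) i * v q)
    w≥0 : ∀ i → 0ℚ ≤ w i
    w≥0 i = sumFin-nonneg _ (λ q → *-nonneg (δ-nonneg (h q) i) (v≥0 q))
    w≡0 : ∀ i → i ∉ K → w i ≡ 0ℚ
    w≡0 i i∉K = trans (sumFin-cong term≡0) (sumFin-zero M)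
      where
      term≡0 : ∀ q → δ (h q) i * v q ≡ 0ℚ
      term≡0 q with h q Fin.≟ i
      ... | yes refl = trans (cong (1ℚ *_) (v≡0 q i∉K)) (ℚP.*-zeroʳ 1ℚ)
      ... | no _     = ℚP.*-zeroˡ (v q)
    Σw≡1 : sumFin w ≡ 1ℚ
    Σw≡1 = begin
      sumFin (λ i → sumFin (λ q → δ (h q) i * v q)) ≡⟨ sumFin-comm (λ i q → δ (h q) i * v q) ⟩
      sumFin (λ q → sumFin (λ i → δ (h q) i * v q)) ≡⟨ sumFin-cong (λ q → sumFin-δ (h q) (λ _ → v q)) ⟩
      sumFin v                                      ≡⟨ Σv≡1 ⟩
      1ℚ                                            ∎
    same-point : lincomb v (λ q → X (h q)) ≐ lincomb w X
    same-point x = sym (begin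
      sumFin (λ i → w i * X i x)
        ≡⟨ sumFin-cong (λ i → ℚP.*-comm (w i) (X i x)) ⟩
      sumFin (λ i → X i x * w i)
        ≡⟨ sumFin-cong (λ i → sumFin-*ˡ (X i x) (λ q → δ (h q) i * v q)) ⟨
      sumFin (λ i → sumFin (λ q → X i x * (δ (h q) i * v q)))
        ≡⟨ sumFin-cong (λ i → sumFin-cong (λ q → reorder (X i x) (δ (h q) i) (v q))) ⟩
      sumFin (λ i → sumFin (λ q → δ (h q) i * (v q * X i x)))
        ≡⟨ sumFin-comm (λ i q → δ (h q) i * (v q * X i x)) ⟩
      sumFin (λ q → sumFin (λ i → δ (h q) i * (v q * X i x)))
        ≡⟨ sumFin-cong (λ q → sumFin-δ (h q) (λ i → v q * X i x)) ⟩
      sumFin (λ q → v q * X (h q) x) ∎)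
      where
      reorder : ∀ a b c → a * (b * c) ≡ b * (c * a)
      reorder = solve 3 (λ a b c → a :* (b :* c) := b :* (c :* a)) refl

  InConv-vertex : ∀ {n d} (X : Fin n → Pt d) (K : Subset n) {i} → i ∈ K → InConv X K (X i)
  InConv-vertex X K {i} i∈K = δ i , δ-nonneg i , δ≡0 , Σδ≡1 , λ x → sym (sumFin-δ i (λ j → X j x))
    where
    δ≡0 : ∀ j → j ∉ K → δ i j ≡ 0ℚ
    δ≡0 j j∉K with i Fin.≟ j
    ... | yes refl = ⊥-elim (j∉K i∈K)
    ... | no _     = refl
    Σδ≡1 : sumFin (δ i) ≡ 1ℚ
    Σδ≡1 = trans (sumFin-cong (λ j → sym (ℚP.*-identityʳ (δ i j)))) (sumFin-δ i (λ _ → 1ℚ))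

  -- Normalising the parts e = e⁺ + e⁻ of an affine dependence by W = Σ e⁺ writes one point as
  -- two affine combinations: Σ (e⁺ / W) P = Σ (- e⁻ / W) P.
  module RadonBalance {M d} (P : Fin M → Pt d) (e e⁺ e⁻ : Fin M → ℚ)
    (split : ∀ q → e⁺ q + e⁻ q ≡ e q) (Σe≡0 : sumFin e ≡ 0ℚ) (Σe·P≡0 : lincomb e P ≐ (λ _ → 0ℚ))
    (W>0 : 0ℚ < sumFin e⁺) where

    open ≡-Reasoning

    W I : ℚ
    W = sumFin e⁺
    I = W ⁻¹

    v a : Fin M → ℚ
    v q = e⁺ q * I
    a q = - (e⁻ q * I)

    private
      I*W≡1 : I * W ≡ 1ℚ
      I*W≡1 = trans (ℚP.*-comm I W) (⁻¹-inverseʳ (λ W≡0 → ℚP.<⇒≢ W>0 (sym W≡0)))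

      Σe⁻≡-W : sumFin e⁻ ≡ - W
      Σe⁻≡-W = inverseʳ-unique W (sumFin e⁻) (trans (sym (sumFin-+ e⁺ e⁻)) (trans (sumFin-cong split) Σe≡0))

    Σv≡1 : sumFin v ≡ 1ℚ
    Σv≡1 = begin
      sumFin (λ q → e⁺ q * I) ≡⟨ sumFin-cong (λ q → ℚP.*-comm (e⁺ q) I) ⟩
      sumFin (λ q → I * e⁺ q) ≡⟨ sumFin-*ˡ I e⁺ ⟩
      I * W                   ≡⟨ I*W≡1 ⟩
      1ℚ                      ∎

    Σa≡1 : sumFin a ≡ 1ℚ
    Σa≡1 = begin
      sumFin (λ q → - (e⁻ q * I))
        ≡⟨ sumFin-neg (λ q → e⁻ q * I) ⟩
      - sumFin (λ q → e⁻ q * I)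
        ≡⟨ cong -_ (trans (sumFin-cong (λ q → ℚP.*-comm (e⁻ q) I)) (sumFin-*ˡ I e⁻)) ⟩
      - (I * sumFin e⁻)
        ≡⟨ cong (λ z → - (I * z)) Σe⁻≡-W ⟩
      - (I * - W)
        ≡⟨ solve 2 (λ I W → :- (I :* :- W) := I :* W) refl I W ⟩
      I * W
        ≡⟨ I*W≡1 ⟩
      1ℚ ∎

    balance : lincomb v P ≐ lincomb a P
    balance x = x∙y⁻¹≈ε⇒x≈y _ _ (begin
      sumFin (λ q → v q * P q x) - sumFin (λ q → a q * P q x)
        ≡⟨ cong (sumFin (λ q → v q * P q x) +_) (sumFin-neg (λ q → a q * P q x)) ⟨
      sumFin (λ q → v q * P q x) + sumFin (λ q → - (a q * P q x))
        ≡⟨ sumFin-+ (λ q → v q * P q x) (λ q → - (a q * P q x)) ⟨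
      sumFin (λ q → v q * P q x + - (a q * P q x))
        ≡⟨ sumFin-cong (λ q → trans (collect (e⁺ q) (e⁻ q) I (P q x)) (cong (λ z → I * (z * P q x)) (split q))) ⟩
      sumFin (λ q → I * (e q * P q x))
        ≡⟨ sumFin-*ˡ I (λ q → e q * P q x) ⟩
      I * lincomb e P x
        ≡⟨ cong (I *_) (Σe·P≡0 x) ⟩
      I * 0ℚ
        ≡⟨ ℚP.*-zeroʳ I ⟩
      0ℚ ∎)
      where
      collect : ∀ a b i p → a * i * p + - (- (b * i) * p) ≡ i * ((a + b) * p)
      collect = solve 4 (λ a b i p → a :* i :* p :+ :- (:- (b :* i) :* p) := i :* ((a :+ b) :* p)) refl

  dependence-meetsHull : ∀ {M n m d} (X : Fin n → Pt d) (L : Plane m d) (K : Subset n)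
    (h : Fin M → Fin n) (e : Fin M → ℚ) → sumFin e ≡ 0ℚ → lincomb e (λ q → X (h q)) ≐ (λ _ → 0ℚ) →
    (∀ q → h q ∈ K → 0ℚ < e q) → (∀ q → h q ∉ K → X (h q) ∈P L) → ∀ q₀ → h q₀ ∈ K →
    ∃ λ y → y ∈P L × InConv X K y
  dependence-meetsHull {M} {d = d} X L K h e Σe≡0 Σe·X≡0 e>0 ∈L q₀ hq₀∈K =
    lincomb v pts , ∈P-resp {L = L} balance (affineCombination-∈P L pts a a≡0⊎∈L Σa≡1) ,
    InConv-reindex X K h v (λ q → *-nonneg (e⁺≥0 q) (ℚP.<⇒≤ (⁻¹-pos W>0))) v≡0 Σv≡1
    where
    pts : Fin M → Pt d
    pts q = X (h q)
    e⁺ e⁻ : Fin M → ℚ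
    e⁺ q = if does (h q ∈? K) then e q else 0ℚ
    e⁻ q = if does (h q ∈? K) then 0ℚ else e q
    split : ∀ q → e⁺ q + e⁻ q ≡ e q
    split q with h q ∈? K
    ... | yes _ = ℚP.+-identityʳ (e q)
    ... | no _  = ℚP.+-identityˡ (e q)
    e⁺≥0 : ∀ q → 0ℚ ≤ e⁺ q
    e⁺≥0 q with h q ∈? K
    ... | yes hq∈K = ℚP.<⇒≤ (e>0 q hq∈K)
    ... | no _     = ℚP.≤-refl
    W>0 : 0ℚ < sumFin e⁺
    W>0 = sumFin-pos e⁺ e⁺≥0 q₀ (e⁺>0 (h q₀ ∈? K))
      where
      e⁺>0 : (d : Dec (h q₀ ∈ K)) → 0ℚ < (if does d then e q₀ else 0ℚ)
      e⁺>0 (yes _)     = e>0 q₀ hq₀∈K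
      e⁺>0 (no hq₀∉K) = ⊥-elim (hq₀∉K hq₀∈K)
    open RadonBalance pts e e⁺ e⁻ split Σe≡0 Σe·X≡0 W>0
    v≡0 : ∀ q → h q ∉ K → v q ≡ 0ℚ
    v≡0 q hq∉K with h q ∈? K
    ... | yes hq∈K = ⊥-elim (hq∉K hq∈K)
    ... | no _     = ℚP.*-zeroˡ I
    a≡0⊎∈L : ∀ q → a q ≡ 0ℚ ⊎ pts q ∈P L
    a≡0⊎∈L q with h q ∈? K
    ... | yes _    = inj₁ (cong -_ (ℚP.*-zeroˡ I))
    ... | no hq∉K = inj₂ (∈L q hq∉K)

  chain-meetsHull : ∀ {N n m d} (t : Fin n → ℚ) (L : Plane m d) (K : Subset n) (h : Fin (suc N) → Fin n) →
    StrictIncr (λ q → t (h q)) → d ℕ.< N → (P : Parity) →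
    (∀ q → h q ∈ K → parity (toℕ q) ≡ P) → (∀ q → h q ∉ K → cyclicVerts d t (h q) ∈P L) →
    ∀ q₀ → h q₀ ∈ K → ∃ λ y → y ∈P L × InConv (cyclicVerts d t) K y
  chain-meetsHull {d = d} t L K h th↑ d<N P parity≡P ∈L q₀ hq₀∈K
    with alternatingDependence (λ q → t (h q)) th↑ d<N P
  ... | e , Σe≡0 , Σe·X≡0 , e>0 =
    dependence-meetsHull (cyclicVerts d t) L K h e Σe≡0 Σe·X≡0 (λ q hq∈K → e>0 q (parity≡P q hq∈K))
      ∈L q₀ hq₀∈K

  -- The coordinates of Σ c_r (γ (u_{r+1}) - γ (u₀)) are the power sums of degrees 1, …, d of the
  -- weights (- Σ c , c₀ , c₁ , …), whose power sum of degree 0 vanishes as well.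
  moment-affineIndependent : ∀ {m d} (u : Fin (suc m) → ℚ) → StrictIncr u → m ℕ.≤ d →
    LinIndep (λ r x → moment d (u (suc r)) x - moment d (u zero) x)
  moment-affineIndependent {m} {d} u u↑ m≤d c Σc·dir≡0 r =
    powerSums≡0⇒weights≡0 d u e u↑ (ℕ.s≤s m≤d) powerSum≡0 (suc r)
    where
    open ≡-Reasoning
    e : Fin (suc m) → ℚ
    e zero    = - sumFin c
    e (suc r) = c r
    powerSum≡differences : ∀ p → powerSum u e p ≡ sumFin (λ r → c r * (pow (u (suc r)) p - pow (u zero) p))
    powerSum≡differences p = sym (begin
      sumFin (λ r → c r * (pow (u (suc r)) p - b))
        ≡⟨ sumFin-cong (λ r → distribute (c r) (pow (u (suc r)) p) b) ⟩
      sumFin (λ r → c r * pow (u (suc r)) p + - (b * c r))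
        ≡⟨ sumFin-+ (λ r → c r * pow (u (suc r)) p) (λ r → - (b * c r)) ⟩
      A + sumFin (λ r → - (b * c r))
        ≡⟨ cong (A +_) (trans (sumFin-neg (λ r → b * c r)) (cong -_ (sumFin-*ˡ b c))) ⟩
      A + - (b * sumFin c)
        ≡⟨ solve 3 (λ A b S → A :+ :- (b :* S) := :- S :* b :+ A) refl A b (sumFin c) ⟩
      - sumFin c * b + A ∎)
      where
      b A : ℚ
      distribute : ∀ c a b → c * (a - b) ≡ c * a + - (b * c)
      distribute = solve 3 (λ c a b → c :* (a :- b) := c :* a :+ :- (b :* c)) refl
      b = pow (u zero) p
      A = sumFin (λ r → c r * pow (u (suc r)) p)
    powerSum≡0 : ∀ p → p ℕ.≤ d → powerSum u e p ≡ 0ℚ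
    powerSum≡0 zero _ = begin
      powerSum u e 0                 ≡⟨ powerSum≡differences 0 ⟩
      sumFin (λ r → c r * (1ℚ - 1ℚ)) ≡⟨ sumFin-cong (λ r → ℚP.*-zeroʳ (c r)) ⟩
      sumFin {m} (λ _ → 0ℚ)          ≡⟨ sumFin-zero m ⟩
      0ℚ                             ∎
    powerSum≡0 (suc p) p<d = begin
      powerSum u e (suc p)
        ≡⟨ powerSum≡differences (suc p) ⟩
      sumFin (λ r → c r * (pow (u (suc r)) (suc p) - pow (u zero) (suc p)))
        ≡⟨ cong (λ i → sumFin (λ r → c r * (pow (u (suc r)) (suc i) - pow (u zero) (suc i)))) (FinP.toℕ-fromℕ< p<d) ⟨
      lincomb c (λ r x → moment d (u (suc r)) x - moment d (u zero) x) (Fin.fromℕ< p<d)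
        ≡⟨ Σc·dir≡0 (Fin.fromℕ< p<d) ⟩
      0ℚ ∎


module GapLayouts where

  open import Data.Nat as ℕ using (ℕ; zero; suc; _+_; _*_; _∸_; _⊓_; _≤_; _<_; z≤n; s≤s)
  import Data.Nat.Properties as ℕP
  open import Data.Nat.Base using (parity)
  open import Data.Nat.DivMod using (_/_; m*n/n≡m; /-monoˡ-≤)
  open import Data.Nat.ListAction using (sum)
  open import Data.Nat.Solver using (module +-*-Solver)
  open import Data.Parity.Base using (Parity; 0ℙ; 1ℙ)
  import Data.Parity.Properties as ℙP
  open import Data.Fin as Fin using (Fin; toℕ)
  open import Data.Fin.Subset using (Subset; _∈_; _∉_; ∣_∣; inside; outside)
  open import Data.Fin.Subset.Properties using (_∈?_)
  open import Data.Vec using ([]; _∷_)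
  open import Data.List as List using (List; []; _∷_; _++_; length; map; take; drop; filter; tabulate; allFin)
  import Data.List.Properties as ListP
  open import Data.List.Membership.Propositional using (find) renaming (_∈_ to _∈ˡ_)
  open import Data.List.Membership.Propositional.Properties using (∈-lookup)
  open import Data.List.Relation.Unary.All as All using (All; []; _∷_)
  open import Data.List.Relation.Unary.All.Properties using (¬Any⇒All¬)
  open import Data.List.Relation.Unary.Any as Any using (any?)
  open import Data.List.Relation.Unary.Any.Properties using (lookup-index)
  open import Data.List.Relation.Unary.AllPairs using (AllPairs; []; _∷_)
  import Data.List.Relation.Unary.AllPairs.Properties as AllPairsP
  open import Data.List.Relation.Binary.Sublist.Propositional using (_⊆_; []; _∷_; _∷ʳ_; from∈; ⊆-refl)
  open import Data.List.Relation.Binary.Sublist.Propositional.Properties using (++⁺; ++⁺ˡ; All-resp-⊆)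
  open import Data.Bool.Base using (true; false; if_then_else_)
  open import Data.Maybe using (Maybe; just; nothing)
  open import Data.Product using (∃; _×_; _,_; proj₁; proj₂)
  open import Data.Sum using (_⊎_; inj₁; inj₂)
  open import Data.Unit using (⊤; tt)
  open import Data.Empty using (⊥-elim)
  open import Function using (_∘_)
  open import Relation.Nullary using (Dec; yes; no; ¬_; does)
  open import Relation.Nullary.Decidable using (dec-true; dec-false)
  open import Relation.Binary.PropositionalEquality
  open +-*-Solver

  AllPairs-⊆ : ∀ {A : Set} {R : A → A → Set} {xs ys} → xs ⊆ ys → AllPairs R ys → AllPairs R xs
  AllPairs-⊆ []         []         = []
  AllPairs-⊆ (y ∷ʳ τ)   (_ ∷ Rys)  = AllPairs-⊆ τ Rys
  AllPairs-⊆ (refl ∷ τ) (Ry ∷ Rys) = All-resp-⊆ τ Ry ∷ AllPairs-⊆ τ Rys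

  AllPairs-lookup : ∀ {A : Set} {R : A → A → Set} {xs} → AllPairs R xs →
    ∀ {i j} → i Fin.< j → R (List.lookup xs i) (List.lookup xs j)
  AllPairs-lookup (Rx ∷ _)  {Fin.zero}  {Fin.suc j} _         = All.lookup Rx (∈-lookup j)
  AllPairs-lookup (_ ∷ Rxs) {Fin.suc i} {Fin.suc j} (s≤s i<j) = AllPairs-lookup Rxs i<j

  allFin-sorted : ∀ n → AllPairs Fin._<_ (allFin n)
  allFin-sorted n = AllPairsP.tabulate⁺-< (λ i<j → i<j)

  -- G₀ s₀ G₁ s₁ … G_J T: gaps G_u separated by single separators s_u; the tail T consists of separators too.
  data Layout (A : Set) : Set where
    final : List A → List A → Layout A
    _⟨_⟩_ : List A → A → Layout A → Layout A

  infixr 5 _⟨_⟩_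

  module _ {A : Set} where

    flatten : Layout A → List A
    flatten (final G T) = G ++ T
    flatten (G ⟨ s ⟩ L) = G ++ s ∷ flatten L

    separators : Layout A → List A
    separators (final G T) = T
    separators (G ⟨ s ⟩ L) = s ∷ separators L

    gaps : Layout A → List (List A)
    gaps (final G T) = G ∷ []
    gaps (G ⟨ s ⟩ L) = G ∷ gaps L

    separators-⊆ : ∀ L → separators L ⊆ flatten L
    separators-⊆ (final G T) = ++⁺ˡ G ⊆-refl
    separators-⊆ (G ⟨ s ⟩ L) = ++⁺ˡ G (refl ∷ separators-⊆ L)

  gapSize : ℕ → ℕ → ℕ
  gapSize a zero    = a
  gapSize a (suc _) = suc a

  -- J + 1 gaps, the first r of size a + 1 and the others of size a (as far as xs reaches).
  layout : ∀ {A : Set} (a r J : ℕ) → List A → Layout A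
  layout a r zero    xs = final (take (gapSize a r) xs) (drop (gapSize a r) xs)
  layout a r (suc J) xs with drop (gapSize a r) xs
  ... | []     = final (take (gapSize a r) xs) []
  ... | s ∷ ys = take (gapSize a r) xs ⟨ s ⟩ layout a (ℕ.pred r) J ys

  capacity : ℕ → ℕ → ℕ → ℕ
  capacity a r zero    = gapSize a r
  capacity a r (suc J) = gapSize a r + capacity a (ℕ.pred r) J

  capacity≡ : ∀ a r J → r ≤ suc J → capacity a r J ≡ a * suc J + r
  capacity≡ a zero    zero    _         = sym (trans (ℕP.+-identityʳ (a * 1)) (ℕP.*-identityʳ a))
  capacity≡ a (suc r) zero    (s≤s z≤n) = sym (trans (ℕP.+-comm (a * 1) 1) (cong suc (ℕP.*-identityʳ a)))
  capacity≡ a zero    (suc J) _         = trans (cong (a +_) (capacity≡ a zero J z≤n))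
    (solve 2 (λ a J → a :+ (a :* (con 1 :+ J) :+ con 0) := a :* (con 2 :+ J) :+ con 0) refl a J)
  capacity≡ a (suc r) (suc J) (s≤s r≤) = trans (cong (suc a +_) (capacity≡ a r J r≤))
    (solve 3 (λ a J r → con 1 :+ a :+ (a :* (con 1 :+ J) :+ r) := a :* (con 2 :+ J) :+ (con 1 :+ r)) refl a J r)

  module _ {A : Set} (a : ℕ) where

    flatten-layout : ∀ r J (xs : List A) → flatten (layout a r J xs) ≡ xs
    flatten-layout r zero    xs = ListP.take++drop≡id (gapSize a r) xs
    flatten-layout r (suc J) xs with drop (gapSize a r) xs in eq
    ... | []     = trans (cong (take (gapSize a r) xs ++_) (sym eq)) (ListP.take++drop≡id (gapSize a r) xs)
    ... | s ∷ ys = trans (cong (λ zs → take (gapSize a r) xs ++ s ∷ zs) (flatten-layout (ℕ.pred r) J ys))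
                         (trans (cong (take (gapSize a r) xs ++_) (sym eq)) (ListP.take++drop≡id (gapSize a r) xs))

    length-gaps-layout : ∀ r J (xs : List A) → length (gaps (layout a r J xs)) ≤ suc J
    length-gaps-layout r zero    xs = ℕP.≤-refl
    length-gaps-layout r (suc J) xs with drop (gapSize a r) xs
    ... | []     = s≤s z≤n
    ... | s ∷ ys = s≤s (length-gaps-layout (ℕ.pred r) J ys)

    private
      length-after-gap : ∀ r J k (xs : List A) → length xs ≡ capacity a r (suc J) + (suc J + k) →
        length (drop (gapSize a r) xs) ≡ suc (capacity a (ℕ.pred r) J + (J + k))
      length-after-gap r J k xs len≡ = begin
        length (drop g xs)        ≡⟨ ListP.length-drop g xs ⟩
        length xs ∸ g             ≡⟨ cong (_∸ g) (trans len≡ (ℕP.+-assoc g c (suc J + k))) ⟩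
        g + (c + suc (J + k)) ∸ g ≡⟨ ℕP.m+n∸m≡n g (c + suc (J + k)) ⟩
        c + suc (J + k)           ≡⟨ ℕP.+-suc c (J + k) ⟩
        suc (c + (J + k))         ∎
        where
        open ≡-Reasoning
        g c : ℕ
        g = gapSize a r
        c = capacity a (ℕ.pred r) J

    length-separators-layout : ∀ r J k (xs : List A) → length xs ≡ capacity a r J + (J + k) →
      length (separators (layout a r J xs)) ≡ J + k
    length-separators-layout r zero    k xs len≡ = trans (ListP.length-drop (gapSize a r) xs)
      (trans (cong (_∸ gapSize a r) len≡) (ℕP.m+n∸m≡n (gapSize a r) k))
    length-separators-layout r (suc J) k xs len≡ with drop (gapSize a r) xs in eq | length-after-gap r J k xs len≡
    ... | []     | ()
    ... | s ∷ ys | len≡′ = cong suc (length-separators-layout (ℕ.pred r) J k ys (ℕP.suc-injective len≡′))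

  length-separators-layout-allFin : ∀ a r J m → r ≤ suc J → J ≤ suc m →
    length (separators (layout a r J (allFin ((m + 1) + a * suc J + r)))) ≡ suc m
  length-separators-layout-allFin a r J m r≤j J≤m+1 = trans
    (length-separators-layout a r J (suc m ∸ J) (allFin _) (begin
      length (allFin ((m + 1) + a * suc J + r))
        ≡⟨ ListP.length-tabulate (λ i → i) ⟩
      (m + 1) + a * suc J + r
        ≡⟨ solve 3 (λ m c r → m :+ con 1 :+ c :+ r := c :+ r :+ (con 1 :+ m)) refl m (a * suc J) r ⟩
      (a * suc J + r) + suc m
        ≡⟨ cong₂ _+_ (capacity≡ a r J r≤j) (ℕP.m+[n∸m]≡n J≤m+1) ⟨
      capacity a r J + (J + (suc m ∸ J)) ∎))
    (ℕP.m+[n∸m]≡n J≤m+1)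
    where open ≡-Reasoning

  GapBounds : ℕ → ℕ → List ℕ → Set
  GapBounds a r []       = ⊤
  GapBounds a r (c ∷ cs) = c ≤ gapSize a r × GapBounds a (ℕ.pred r) cs

  GapBounds-map : ∀ {A : Set} {f g : A → ℕ} a r → (∀ x → f x ≤ g x) → (xs : List A) →
    GapBounds a r (map g xs) → GapBounds a r (map f xs)
  GapBounds-map a r f≤g []       _          = tt
  GapBounds-map a r f≤g (x ∷ xs) (gx≤ , bs) = ℕP.≤-trans (f≤g x) gx≤ , GapBounds-map a (ℕ.pred r) f≤g xs bs

  private
    length-take≤ : ∀ {A : Set} n (xs : List A) → length (take n xs) ≤ n
    length-take≤ n xs = subst (_≤ n) (sym (ListP.length-take n xs)) (ℕP.m⊓n≤m n (length xs))

  layout-GapBounds : ∀ {A : Set} a r J (xs : List A) → GapBounds a r (map length (gaps (layout a r J xs)))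
  layout-GapBounds a r zero    xs = length-take≤ (gapSize a r) xs , tt
  layout-GapBounds a r (suc J) xs with drop (gapSize a r) xs
  ... | []     = length-take≤ (gapSize a r) xs , tt
  ... | s ∷ ys = length-take≤ (gapSize a r) xs , layout-GapBounds a (ℕ.pred r) J ys

  nonzeros : List ℕ → ℕ
  nonzeros []           = 0
  nonzeros (zero  ∷ cs) = nonzeros cs
  nonzeros (suc _ ∷ cs) = suc (nonzeros cs)

  sum≤nonzeros : ∀ a r cs → GapBounds a r cs → sum cs ≤ a * nonzeros cs + nonzeros cs ⊓ r
  sum≤nonzeros a r       []           _          = z≤n
  sum≤nonzeros a r       (zero  ∷ cs) (_ , bs)   = ℕP.≤-trans (sum≤nonzeros a (ℕ.pred r) cs bs)
    (ℕP.+-monoʳ-≤ (a * nonzeros cs) (ℕP.⊓-monoʳ-≤ (nonzeros cs) (ℕP.pred[n]≤n {r})))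
  sum≤nonzeros a zero    (suc c ∷ cs) (c<a , bs) = begin
    suc c + sum cs
      ≤⟨ ℕP.+-mono-≤ c<a (sum≤nonzeros a 0 cs bs) ⟩
    a + (a * O + O ⊓ 0)
      ≡⟨ cong (λ z → a + (a * O + z)) (ℕP.⊓-zeroʳ O) ⟩
    a + (a * O + 0)
      ≡⟨ solve 2 (λ a O → a :+ (a :* O :+ con 0) := a :* (con 1 :+ O) :+ con 0) refl a O ⟩
    a * suc O + 0
      ≡⟨ cong (a * suc O +_) (ℕP.⊓-zeroʳ (suc O)) ⟨
    a * suc O + suc O ⊓ 0 ∎
    where
    open ℕP.≤-Reasoning
    O : ℕ
    O = nonzeros cs
  sum≤nonzeros a (suc r) (suc c ∷ cs) (c<a+1 , bs) = begin
    suc c + sum cs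
      ≤⟨ ℕP.+-mono-≤ c<a+1 (sum≤nonzeros a r cs bs) ⟩
    suc a + (a * O + O ⊓ r)
      ≡⟨ solve 3 (λ a O m → con 1 :+ a :+ (a :* O :+ m) := a :* (con 1 :+ O) :+ (con 1 :+ m)) refl a O (O ⊓ r) ⟩
    a * suc O + suc (O ⊓ r) ∎
    where
    open ℕP.≤-Reasoning
    O : ℕ
    O = nonzeros cs

  fewGaps⇒load≤k-1 : ∀ {k j λ′ a r} →
    ((j + λ′) / 2 ≤ r → (j + λ′) / 2 * (a + 1) ≤ k ∸ 1) →
    (r ≤ (j + λ′) / 2 ∸ 1 → (a + 1) * r + ((j + λ′) / 2 ∸ r) * a ≤ k ∸ 1) →
    ∀ O → 2 * O ≤ j + λ′ → a * O + O ⊓ r ≤ k ∸ 1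
  fewGaps⇒load≤k-1 {k} {j} {λ′} {a} {r} big small O 2O≤ =
    ℕP.≤-trans (ℕP.+-mono-≤ (ℕP.*-monoʳ-≤ a O≤β) (ℕP.⊓-monoˡ-≤ r O≤β)) (β-load (β ℕ.≤? r))
    where
    β : ℕ
    β = (j + λ′) / 2
    O≤β : O ≤ β
    O≤β = subst (_≤ β) (trans (cong (_/ 2) (ℕP.*-comm 2 O)) (m*n/n≡m O 2)) (/-monoˡ-≤ 2 2O≤)
    β-load : Dec (β ≤ r) → a * β + β ⊓ r ≤ k ∸ 1
    β-load (yes β≤r) = subst (_≤ k ∸ 1) load≡ (big β≤r)
      where
      load≡ : β * (a + 1) ≡ a * β + β ⊓ r
      load≡ = trans (solve 2 (λ β a → β :* (a :+ con 1) := a :* β :+ β) refl β a)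
                    (cong (a * β +_) (sym (ℕP.m≤n⇒m⊓n≡m β≤r)))
    β-load (no β≰r) = subst (_≤ k ∸ 1) load≡ (small r≤β-1)
      where
      r≤β : r ≤ β
      r≤β = ℕP.<⇒≤ (ℕP.≰⇒> β≰r)
      r≤β-1 : r ≤ β ∸ 1
      r≤β-1 = ℕP.m+n≤o⇒m≤o∸n r (subst (_≤ β) (ℕP.+-comm 1 r) (ℕP.≰⇒> β≰r))
      load≡ : (a + 1) * r + (β ∸ r) * a ≡ a * β + β ⊓ r
      load≡ = trans (solve 3 (λ a r x → (a :+ con 1) :* r :+ x :* a := a :* (r :+ x) :+ r) refl a r (β ∸ r))
                    (cong₂ (λ z w → a * z + w) (ℕP.m+[n∸m]≡n r≤β) (sym (ℕP.m≥n⇒m⊓n≡n r≤β)))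

  count : ∀ {n} → Subset n → List (Fin n) → ℕ
  count K xs = length (filter (_∈? K) xs)

  module _ {n} (K : Subset n) where

    count-++ : ∀ xs ys → count K (xs ++ ys) ≡ count K xs + count K ys
    count-++ xs ys = trans (cong length (ListP.filter-++ (_∈? K) xs ys)) (ListP.length-++ (filter (_∈? K) xs))

    count-∈ : ∀ {i} xs → i ∈ K → count K (i ∷ xs) ≡ suc (count K xs)
    count-∈ xs i∈K = cong length (ListP.filter-accept (_∈? K) i∈K)

    count-∉ : ∀ {i} xs → i ∉ K → count K (i ∷ xs) ≡ count K xs
    count-∉ xs i∉K = cong length (ListP.filter-reject (_∈? K) i∉K)

    count-∈-∉ : ∀ {i s} xs → i ∈ K → s ∉ K → count K (i ∷ s ∷ xs) ≡ suc (count K xs)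
    count-∈-∉ {s = s} xs i∈K s∉K = trans (count-∈ (s ∷ xs) i∈K) (cong suc (count-∉ xs s∉K))

    count≤length : ∀ xs → count K xs ≤ length xs
    count≤length = ListP.length-filter (_∈? K)

    count-none : ∀ {xs} → All (_∉ K) xs → count K xs ≡ 0
    count-none none = cong length (ListP.filter-none (_∈? K) none)

    count≥1⇒∃lookup∈ : ∀ xs → 1 ≤ count K xs → ∃ λ q → List.lookup xs q ∈ K
    count≥1⇒∃lookup∈ xs count≥1 with any? (_∈? K) xs
    ... | yes some = Any.index some , lookup-index some
    ... | no none  = ⊥-elim (ℕP.<⇒≢ count≥1 (sym (count-none (¬Any⇒All¬ xs none))))

    count-flatten : ∀ L → count K (flatten L) ≡ sum (map (count K) (gaps L)) + count K (separators L)
    count-flatten (final G T) = trans (count-++ G T) (cong (_+ count K T) (sym (ℕP.+-identityʳ (count K G))))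
    count-flatten (G ⟨ s ⟩ L) = begin
      count K (G ++ s ∷ flatten L)
        ≡⟨ count-++ G (s ∷ flatten L) ⟩
      count K G + count K (s ∷ flatten L)
        ≡⟨ cong (count K G +_) (count-++ (s ∷ []) (flatten L)) ⟩
      count K G + (count K (s ∷ []) + count K (flatten L))
        ≡⟨ cong (λ z → count K G + (count K (s ∷ []) + z)) (count-flatten L) ⟩
      cG + (cs + (S + cT))
        ≡⟨ solve 4 (λ cG cs S cT → cG :+ (cs :+ (S :+ cT)) := cG :+ S :+ (cs :+ cT)) refl cG cs S cT ⟩
      cG + S + (cs + cT)
        ≡⟨ cong (cG + S +_) (count-++ (s ∷ []) (separators L)) ⟨
      cG + S + count K (s ∷ separators L) ∎
      where
      open ≡-Reasoning
      cG cs S cT : ℕ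
      cG = count K G
      cs = count K (s ∷ [])
      S  = sum (map (count K) (gaps L))
      cT = count K (separators L)

  count-tabulate-suc : ∀ {k n} b (K : Subset n) (f : Fin k → Fin n) →
    count (b ∷ K) (tabulate (Fin.suc ∘ f)) ≡ count K (tabulate f)
  count-tabulate-suc {zero}  b K f = refl
  count-tabulate-suc {suc k} b K f with f Fin.zero ∈? K
  ... | yes _ = cong suc (count-tabulate-suc b K (f ∘ Fin.suc))
  ... | no _  = count-tabulate-suc b K (f ∘ Fin.suc)

  count-allFin : ∀ {n} (K : Subset n) → count K (allFin n) ≡ ∣ K ∣
  count-allFin []            = refl
  count-allFin (inside ∷ K)  = cong suc (trans (count-tabulate-suc inside K (λ i → i)) (count-allFin K))
  count-allFin (outside ∷ K) = trans (count-tabulate-suc outside K (λ i → i)) (count-allFin K)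

  Pickable : Maybe Parity → ℕ → Set
  Pickable nothing  _ = ⊤
  Pickable (just P) l = parity l ≡ P

  pickable? : ∀ mP l → Dec (Pickable mP l)
  pickable? nothing  _ = yes tt
  pickable? (just P) l = parity l ℙP.≟ P

  ¬Pickable⇒Pickable-suc : ∀ mP l → ¬ Pickable mP l → Pickable mP (suc l)
  ¬Pickable⇒Pickable-suc nothing   l             ¬ok = ⊥-elim (¬ok tt)
  ¬Pickable⇒Pickable-suc (just 0ℙ) zero          ¬ok = ⊥-elim (¬ok refl)
  ¬Pickable⇒Pickable-suc (just 1ℙ) zero          ¬ok = refl
  ¬Pickable⇒Pickable-suc (just 0ℙ) (suc zero)    ¬ok = refl
  ¬Pickable⇒Pickable-suc (just 1ℙ) (suc zero)    ¬ok = ⊥-elim (¬ok refl)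
  ¬Pickable⇒Pickable-suc (just P)  (suc (suc l)) ¬ok = ¬Pickable⇒Pickable-suc (just P) l ¬ok

  waiting : Maybe Parity → ℕ → ℕ
  waiting mP l = if does (pickable? mP l) then 0 else 1

  waiting≡0 : ∀ {mP l} → Pickable mP l → waiting mP l ≡ 0
  waiting≡0 {mP} {l} ok rewrite dec-true (pickable? mP l) ok = refl

  waiting≡1 : ∀ {mP l} → ¬ Pickable mP l → waiting mP l ≡ 1
  waiting≡1 {mP} {l} ¬ok rewrite dec-false (pickable? mP l) ¬ok = refl

  waiting≤1 : ∀ mP l → waiting mP l ≤ 1
  waiting≤1 mP l with does (pickable? mP l)
  ... | true  = z≤n
  ... | false = s≤s z≤n

  Compatible : Maybe Parity → Parity → Set
  Compatible nothing   _ = ⊤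
  Compatible (just P′) P = P′ ≡ P

  -- The state (mP , l) of the scan is the target parity (nothing before the first pick) and the
  -- length of the output so far. From each gap at most one point of K is picked, and only at an
  -- output position of the target parity; separators are always kept.
  module Scan {n} (K : Subset n) where

    data GapChoice (mP : Maybe Parity) (l : ℕ) (G : List (Fin n)) : Set where
      pick : ∀ {i} → i ∈ K → i ∈ˡ G → Pickable mP l → GapChoice mP l G
      skip : ¬ Pickable mP l ⊎ All (_∉ K) G → GapChoice mP l G

    gapChoice : ∀ mP l G → GapChoice mP l G
    gapChoice mP l G with pickable? mP l | any? (_∈? K) G
    ... | no ¬ok | _       = skip (inj₁ ¬ok)
    ... | yes ok | no ¬any = skip (inj₂ (¬Any⇒All¬ G ¬any))
    ... | yes ok | yes any with find any
    ...   | _ , i∈G , i∈K = pick i∈K i∈G ok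

    scan : Maybe Parity → ℕ → Layout (Fin n) → List (Fin n)
    scan mP l (final G T) with gapChoice mP l G
    ... | pick {i} _ _ _ = i ∷ T
    ... | skip _         = T
    scan mP l (G ⟨ s ⟩ L) with gapChoice mP l G
    ... | pick {i} _ _ _ = i ∷ s ∷ scan (just (parity l)) (suc (suc l)) L
    ... | skip _         = s ∷ scan mP (suc l) L

    scan-⊆ : ∀ mP l L → scan mP l L ⊆ flatten L
    scan-⊆ mP l (final G T) with gapChoice mP l G
    ... | pick _ i∈G _ = ++⁺ (from∈ i∈G) ⊆-refl
    ... | skip _       = ++⁺ˡ G ⊆-refl
    scan-⊆ mP l (G ⟨ s ⟩ L) with gapChoice mP l G
    ... | pick _ i∈G _ = ++⁺ (from∈ i∈G) (refl ∷ scan-⊆ (just (parity l)) (suc (suc l)) L)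
    ... | skip _       = ++⁺ˡ G (refl ∷ scan-⊆ mP (suc l) L)

    ParityChain : (Fin n → Set) → Parity → ℕ → List (Fin n) → Set
    ParityChain V P l []      = ⊤
    ParityChain V P l (i ∷ M) = (i ∈ K → parity l ≡ P) × (i ∉ K → V i) × ParityChain V P (suc l) M

    ParityChain-lookup : ∀ {V P l} M → ParityChain V P l M → ∀ q →
      (List.lookup M q ∈ K → parity (l + toℕ q) ≡ P) × (List.lookup M q ∉ K → V (List.lookup M q))
    ParityChain-lookup {P = P} {l} (i ∷ M) (parity≡ , V-i , _) Fin.zero =
      subst (λ z → i ∈ K → parity z ≡ P) (sym (ℕP.+-identityʳ l)) parity≡ , V-i
    ParityChain-lookup {P = P} {l} (i ∷ M) (_ , _ , chain) (Fin.suc q) =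
      subst (λ z → List.lookup M q ∈ K → parity z ≡ P) (sym (ℕP.+-suc l (toℕ q))) (proj₁ rest) , proj₂ rest
      where rest = ParityChain-lookup M chain q

    private
      separatorsChain : ∀ {V P l T} → All (_∉ K) T → All V T → ParityChain V P l T
      separatorsChain []            []          = tt
      separatorsChain (s∉K ∷ s∉Ks) (V-s ∷ V-ss) =
        (λ s∈K → ⊥-elim (s∉K s∈K)) , (λ _ → V-s) , separatorsChain s∉Ks V-ss

      compatible : ∀ mP l → Pickable mP l → Compatible mP (parity l)
      compatible nothing  l _  = tt
      compatible (just P) l ok = sym ok

      someCompatible : ∀ mP → ∃ (Compatible mP)
      someCompatible nothing  = 0ℙ , tt
      someCompatible (just P) = P , refl

    scan-ParityChain : ∀ {V} mP l L → All (_∉ K) (separators L) → All V (separators L) →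
      ∃ λ P → Compatible mP P × ParityChain V P l (scan mP l L)
    scan-ParityChain mP l (final G T) S∉K V-S with gapChoice mP l G
    ... | pick i∈K _ ok =
      parity l , compatible mP l ok , (λ _ → refl) , (λ i∉K → ⊥-elim (i∉K i∈K)) , separatorsChain S∉K V-S
    ... | skip _        = proj₁ (someCompatible mP) , proj₂ (someCompatible mP) , separatorsChain S∉K V-S
    scan-ParityChain mP l (G ⟨ s ⟩ L) (s∉K ∷ S∉K) (V-s ∷ V-S) with gapChoice mP l G
    ... | pick i∈K _ ok with scan-ParityChain (just (parity l)) (suc (suc l)) L S∉K V-S
    ...   | P , parity≡P , chain = P , compatible′ mP ok ,
            (λ _ → parity≡P) , (λ i∉K → ⊥-elim (i∉K i∈K)) , (λ s∈K → ⊥-elim (s∉K s∈K)) , (λ _ → V-s) , chain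
      where
      compatible′ : ∀ mP → Pickable mP l → Compatible mP P
      compatible′ nothing  _  = tt
      compatible′ (just _) ok = trans (sym ok) parity≡P
    scan-ParityChain mP l (G ⟨ s ⟩ L) (s∉K ∷ S∉K) (V-s ∷ V-S) | skip _
      with scan-ParityChain mP (suc l) L S∉K V-S
    ...   | P , compat , chain = P , compat , (λ s∈K → ⊥-elim (s∉K s∈K)) , (λ _ → V-s) , chain

    length-scan : ∀ mP l L → All (_∉ K) (separators L) →
      length (scan mP l L) ≡ length (separators L) + count K (scan mP l L)
    length-scan mP l (final G T) S∉K with gapChoice mP l G
    ... | pick {i} i∈K _ _ = begin
      suc (length T)             ≡⟨ ℕP.+-comm 1 (length T) ⟩
      length T + 1               ≡⟨ cong (λ z → length T + suc z) (count-none K S∉K) ⟨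
      length T + suc (count K T) ≡⟨ cong (length T +_) (count-∈ K T i∈K) ⟨
      length T + count K (i ∷ T) ∎
      where open ≡-Reasoning
    ... | skip _ = trans (sym (ℕP.+-identityʳ (length T))) (cong (length T +_) (sym (count-none K S∉K)))
    length-scan mP l (G ⟨ s ⟩ L) (s∉K ∷ S∉K) with gapChoice mP l G
    ... | pick {i} i∈K _ _ = begin
      suc (suc (length M))
        ≡⟨ cong (suc ∘ suc) (length-scan (just (parity l)) (suc (suc l)) L S∉K) ⟩
      suc (suc (length (separators L) + count K M))
        ≡⟨ cong suc (ℕP.+-suc (length (separators L)) (count K M)) ⟨
      suc (length (separators L) + suc (count K M))
        ≡⟨ cong (λ z → suc (length (separators L) + z)) (count-∈-∉ K M i∈K s∉K) ⟨
      suc (length (separators L) + count K (i ∷ s ∷ M)) ∎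
      where
      open ≡-Reasoning
      M : List (Fin n)
      M = scan (just (parity l)) (suc (suc l)) L
    ... | skip _ = cong suc (trans (length-scan mP (suc l) L S∉K)
                     (cong (length (separators L) +_) (sym (count-∉ K (scan mP (suc l) L) s∉K))))

    private
      2*nonzeros-∷ : ∀ c cs → 2 * nonzeros (c ∷ cs) ≤ 2 + 2 * nonzeros cs
      2*nonzeros-∷ zero    cs = ℕP.m≤n+m (2 * nonzeros cs) 2
      2*nonzeros-∷ (suc c) cs = ℕP.≤-reflexive (ℕP.*-suc 2 (nonzeros cs))

      grow : ∀ c {cs X} → 2 * nonzeros cs ≤ X → 2 * nonzeros (c ∷ cs) ≤ 2 + X
      grow c {cs} ≤X = ℕP.≤-trans (2*nonzeros-∷ c cs) (ℕP.+-monoʳ-≤ 2 ≤X)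

      picks-bound-final : ∀ mP l G T → All (_∉ K) T →
        2 * nonzeros (count K G ∷ []) ≤ 1 + count K (scan mP l (final G T)) + waiting mP l
      picks-bound-final mP l G T T∉K with gapChoice mP l G
      ... | pick {i} i∈K _ ok = begin
        2 * nonzeros (count K G ∷ [])
          ≤⟨ 2*nonzeros-∷ (count K G) [] ⟩
        2
          ≡⟨ cong₂ (λ c w → 1 + suc c + w) (count-none K T∉K) (waiting≡0 ok) ⟨
        1 + suc (count K T) + waiting mP l
          ≡⟨ cong (λ c → 1 + c + waiting mP l) (count-∈ K T i∈K) ⟨
        1 + count K (i ∷ T) + waiting mP l ∎
        where open ℕP.≤-Reasoning
      ... | skip (inj₁ ¬ok) = begin
        2 * nonzeros (count K G ∷ []) ≤⟨ 2*nonzeros-∷ (count K G) [] ⟩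
        2                             ≡⟨ cong₂ (λ c w → 1 + c + w) (count-none K T∉K) (waiting≡1 ¬ok) ⟨
        1 + count K T + waiting mP l  ∎
        where open ℕP.≤-Reasoning
      ... | skip (inj₂ G∉K) rewrite count-none K G∉K = z≤n

    -- A nonempty gap is skipped only when it is not pickable, and then the next gap is pickable:
    -- the potential waiting pays for the skipped gap.
    picks-bound : ∀ mP l L → All (_∉ K) (separators L) →
      2 * nonzeros (map (count K) (gaps L)) ≤ length (gaps L) + count K (scan mP l L) + waiting mP l
    picks-bound mP l (final G T) T∉K = picks-bound-final mP l G T T∉K
    picks-bound mP l (G ⟨ s ⟩ L) (s∉K ∷ S∉K) with gapChoice mP l G
    ... | pick {i} i∈K _ ok = begin
      2 * nonzeros (count K G ∷ cs)
        ≤⟨ grow (count K G) (picks-bound (just (parity l)) (suc (suc l)) L S∉K) ⟩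
      2 + (g + count K M + waiting (just (parity l)) (suc (suc l)))
        ≡⟨ cong (λ w → 2 + (g + count K M + w)) (waiting≡0 {just (parity l)} {suc (suc l)} refl) ⟩
      2 + (g + count K M + 0)
        ≡⟨ solve 2 (λ g c → con 2 :+ (g :+ c :+ con 0) := con 1 :+ g :+ (con 1 :+ c) :+ con 0) refl g (count K M) ⟩
      suc g + suc (count K M) + 0
        ≡⟨ cong₂ (λ c w → suc g + c + w) (count-∈-∉ K M i∈K s∉K) (waiting≡0 ok) ⟨
      suc g + count K (i ∷ s ∷ M) + waiting mP l ∎
      where
      open ℕP.≤-Reasoning
      g : ℕ
      g = length (gaps L)
      cs : List ℕ
      cs = map (count K) (gaps L)
      M : List (Fin n)
      M = scan (just (parity l)) (suc (suc l)) L
    ... | skip (inj₁ ¬ok) = begin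
      2 * nonzeros (count K G ∷ cs)
        ≤⟨ grow (count K G) (picks-bound mP (suc l) L S∉K) ⟩
      2 + (g + count K M + waiting mP (suc l))
        ≡⟨ cong (λ w → 2 + (g + count K M + w)) (waiting≡0 (¬Pickable⇒Pickable-suc mP l ¬ok)) ⟩
      2 + (g + count K M + 0)
        ≡⟨ solve 2 (λ g c → con 2 :+ (g :+ c :+ con 0) := con 1 :+ g :+ c :+ con 1) refl g (count K M) ⟩
      suc g + count K M + 1
        ≡⟨ cong₂ (λ c w → suc g + c + w) (count-∉ K M s∉K) (waiting≡1 ¬ok) ⟨
      suc g + count K (s ∷ M) + waiting mP l ∎
      where
      open ℕP.≤-Reasoning
      g : ℕ
      g = length (gaps L)
      cs : List ℕ
      cs = map (count K) (gaps L)
      M : List (Fin n)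
      M = scan mP (suc l) L
    ... | skip (inj₂ G∉K) rewrite count-none K G∉K = begin
      2 * nonzeros (map (count K) (gaps L))
        ≤⟨ picks-bound mP (suc l) L S∉K ⟩
      g + count K M + waiting mP (suc l)
        ≤⟨ ℕP.+-monoʳ-≤ (g + count K M) (waiting≤1 mP (suc l)) ⟩
      g + count K M + 1
        ≡⟨ solve 2 (λ g c → g :+ c :+ con 1 := con 1 :+ g :+ c) refl g (count K M) ⟩
      suc g + count K M
        ≤⟨ ℕP.m≤m+n (suc g + count K M) (waiting mP l) ⟩
      suc g + count K M + waiting mP l
        ≡⟨ cong (λ c → suc g + c + waiting mP l) (count-∉ K M s∉K) ⟨
      suc g + count K (s ∷ M) + waiting mP l ∎
      where
      open ℕP.≤-Reasoning
      g : ℕ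
      g = length (gaps L)
      M : List (Fin n)
      M = scan mP (suc l) L

  enough-picks : ∀ {n k λ′} a r J (K : Subset n) → 1 ≤ k →
    ((suc J + λ′) / 2 ≤ r → (suc J + λ′) / 2 * (a + 1) ≤ k ∸ 1) →
    (r ≤ (suc J + λ′) / 2 ∸ 1 → (a + 1) * r + ((suc J + λ′) / 2 ∸ r) * a ≤ k ∸ 1) →
    ∣ K ∣ ≡ k → All (_∉ K) (separators (layout a r J (allFin n))) →
    λ′ < count K (Scan.scan K nothing 0 (layout a r J (allFin n)))
  enough-picks {n} {k} {λ′} a r J K 1≤k big small |K|≡k S∉K = ℕP.≰⇒> λ few →
    k≰k-1 1≤k (ℕP.≤-trans k≤load (fewGaps⇒load≤k-1 {k} {suc J} {λ′} big small O (2O≤ few)))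
    where
    open Scan K
    open ℕP.≤-Reasoning
    L : Layout (Fin n)
    L = layout a r J (allFin n)
    O : ℕ
    O = nonzeros (map (count K) (gaps L))
    2O≤ : count K (scan nothing 0 L) ≤ λ′ → 2 * O ≤ suc J + λ′
    2O≤ few = begin
      2 * O
        ≤⟨ picks-bound nothing 0 L S∉K ⟩
      length (gaps L) + count K (scan nothing 0 L) + 0
        ≡⟨ ℕP.+-identityʳ _ ⟩
      length (gaps L) + count K (scan nothing 0 L)
        ≤⟨ ℕP.+-mono-≤ (length-gaps-layout a r J (allFin n)) few ⟩
      suc J + λ′ ∎
    k≤load : k ≤ a * O + O ⊓ r
    k≤load = begin
      k                                   ≡⟨ trans (sym |K|≡k) (sym (count-allFin K)) ⟩
      count K (allFin n)                  ≡⟨ cong (count K) (flatten-layout a r J (allFin n)) ⟨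
      count K (flatten L)                 ≡⟨ count-flatten K L ⟩
      Σgaps + count K (separators L)      ≡⟨ cong (Σgaps +_) (count-none K S∉K) ⟩
      Σgaps + 0                           ≡⟨ ℕP.+-identityʳ Σgaps ⟩
      Σgaps                               ≤⟨ sum≤nonzeros a r _ gapsBounded ⟩
      a * O + O ⊓ r                       ∎
      where
      Σgaps : ℕ
      Σgaps = sum (map (count K) (gaps L))
      gapsBounded : GapBounds a r (map (count K) (gaps L))
      gapsBounded = GapBounds-map a r (count≤length K) (gaps L) (layout-GapBounds a r J (allFin n))
    k≰k-1 : ∀ {k} → 1 ≤ k → ¬ (k ≤ k ∸ 1)
    k≰k-1 {suc k} _ = ℕP.n≮n k


open import Data.Nat as ℕ using (ℕ; zero; suc; _+_; _*_; _∸_; _≤_; _<_; _/_; z≤n; s≤s)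
import Data.Nat.Properties as ℕP
open import Data.Fin as Fin using (Fin)
import Data.Fin.Properties as FinP
open import Data.Fin.Subset using (Subset; _∈_; _∉_; ∣_∣)
open import Data.Fin.Subset.Properties using (_∈?_)
open import Data.List as List using (List; _∷_; length; allFin)
open import Data.List.Membership.Propositional using (find)
open import Data.List.Relation.Unary.All as All using (All)
open import Data.List.Relation.Unary.All.Properties using (¬Any⇒All¬)
open import Data.List.Relation.Unary.Any as Any using (any?)
open import Data.List.Relation.Unary.Any.Properties using (lookup-index)
open import Data.List.Relation.Unary.AllPairs using (AllPairs)
open import Data.Maybe using (nothing)
open import Data.Parity.Base using (Parity)
open import Data.Rational using (ℚ)
open import Data.Product using (∃; _×_; _,_; proj₁; proj₂)
open import Data.Empty using (⊥-elim)
open import Function using (_∘_)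
open import Function.Definitions using (Injective)
open import Relation.Nullary using (yes; no)
open import Relation.Binary.Definitions using (tri<; tri≈; tri>)
open import Relation.Binary.PropositionalEquality

open MomentCurve using (affineSpan; affineSpan-∋; moment-affineIndependent; chain-meetsHull; InConv-vertex)
open GapLayouts

strictMono⇒injective : ∀ {k n} {f : Fin k → Fin n} → (∀ {i j} → i Fin.< j → f i Fin.< f j) →
  Injective _≡_ _≡_ f
strictMono⇒injective f↑ {i} {j} fi≡fj with FinP.<-cmp i j
... | tri< i<j _ _ = ⊥-elim (FinP.<-irrefl fi≡fj (f↑ i<j))
... | tri≈ _ i≡j _ = i≡j
... | tri> _ _ j<i = ⊥-elim (FinP.<-irrefl (sym fi≡fj) (f↑ j<i))

parityChain-meetsHull : ∀ {n m d} (t : Fin n → ℚ) → StrictIncr t → (L : Plane m d) (K : Subset n) {P : Parity}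
  (M : List (Fin n)) → AllPairs Fin._<_ M → Scan.ParityChain K (λ i → cyclicVerts d t i ∈P L) P 0 M →
  suc (suc d) ≤ length M → 1 ≤ count K M → ∃ λ y → y ∈P L × InConv (cyclicVerts d t) K y
parityChain-meetsHull {n} t t↑ L K {P} (i ∷ M) M↑ chain (s≤s d<N) count≥1 =
  chain-meetsHull t L K h (λ q q′ q<q′ → t↑ (h q) (h q′) (AllPairs-lookup M↑ q<q′)) d<N P
    (λ q → proj₁ (ParityChain-lookup (i ∷ M) chain q)) (λ q → proj₂ (ParityChain-lookup (i ∷ M) chain q))
    (proj₁ q₀) (proj₂ q₀)
  where
  open Scan K
  h : Fin (suc (length M)) → Fin n
  h = List.lookup (i ∷ M)
  q₀ : ∃ λ q → h q ∈ K
  q₀ = count≥1⇒∃lookup∈ K (i ∷ M) count≥1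

module SeparatorPlane {n m d λ′} (t : Fin n → ℚ) (t↑ : StrictIncr t) (L : Layout (Fin n))
  (sorted : AllPairs Fin._<_ (flatten L)) (|S|≡ : length (separators L) ≡ suc m) (m+λ′≡d : m + λ′ ≡ d) where

  S : List (Fin n)
  S = separators L

  vertex : Fin (suc m) → Fin n
  vertex s = List.lookup S (Fin.cast (sym |S|≡) s)

  vertex↑ : ∀ {s s′} → s Fin.< s′ → vertex s Fin.< vertex s′
  vertex↑ {s} {s′} s<s′ = AllPairs-lookup (AllPairs-⊆ (separators-⊆ L) sorted)
    (subst₂ ℕ._<_ (sym (FinP.toℕ-cast (sym |S|≡) s)) (sym (FinP.toℕ-cast (sym |S|≡) s′)) s<s′)

  plane : Plane m d
  plane = affineSpan (λ s → cyclicVerts d t (vertex s))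
    (moment-affineIndependent (t ∘ vertex) (λ s s′ s<s′ → t↑ _ _ (vertex↑ s<s′)) m≤d)
    where
    m≤d : m ≤ d
    m≤d = ℕP.m+n≤o⇒m≤o m (ℕP.≤-reflexive m+λ′≡d)

  vertex∈plane : ∀ s → cyclicVerts d t (vertex s) ∈P plane
  vertex∈plane = affineSpan-∋ (λ s → cyclicVerts d t (vertex s)) (Plane.indep plane)

  separator∈plane : All (λ i → cyclicVerts d t i ∈P plane) S
  separator∈plane = All.tabulate λ {x} x∈S → subst (λ i → cyclicVerts d t i ∈P plane)
    (trans (cong (List.lookup S) (FinP.cast-involutive (sym |S|≡) |S|≡ (Any.index x∈S))) (sym (lookup-index x∈S)))
    (vertex∈plane (Fin.cast |S|≡ (Any.index x∈S)))

  plane-meetsHull : (K : Subset n) → All (_∉ K) S → λ′ < count K (Scan.scan K nothing 0 L) →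
    ∃ λ y → y ∈P plane × InConv (cyclicVerts d t) K y
  plane-meetsHull K S∉K λ′<c with Scan.scan-ParityChain K nothing 0 L S∉K separator∈plane
  ... | P , _ , chain = parityChain-meetsHull t t↑ plane K M (AllPairs-⊆ (scan-⊆ nothing 0 L) sorted) chain
          (subst (_≤ length M) (cong (suc ∘ suc) m+λ′≡d) long) (ℕP.≤-trans (s≤s z≤n) λ′<c)
    where
    open Scan K
    M : List (Fin n)
    M = scan nothing 0 L
    long : suc (suc (m + λ′)) ≤ length M
    long = subst (suc (suc (m + λ′)) ≤_) (sym (trans (length-scan nothing 0 L S∉K) (cong (_+ count K M) |S|≡)))
             (subst (_≤ suc m + count K M) (cong suc (ℕP.+-suc m λ′)) (ℕP.+-monoʳ-≤ (suc m) λ′<c))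

proposition7 : (k d λ' j a r : ℕ) → 1 ≤ k → 1 ≤ d → 1 ≤ λ' → λ' ≤ d → λ' + 1 ≤ k →
    λ' + 1 ≤ j → j ≤ d ∸ λ' + 2 → r < j →
    (((j + λ') / 2) ≤ r → ((j + λ') / 2) * (a + 1) ≤ k ∸ 1) →
    (r ≤ (j + λ') / 2 ∸ 1 → (a + 1) * r + ((j + λ') / 2 ∸ r) * a ≤ k ∸ 1) →
    (t : Fin ((d ∸ λ' + 1) + a * j + r) → ℚ) → StrictIncr t →
    ∃ λ (L : Plane (d ∸ λ') d) → CompleteKneserTransversal (d ∸ λ') k (cyclicVerts d t) L
proposition7 k d λ' zero a r _ _ _ _ _ λ'+1≤0 = ⊥-elim (ℕP.n≮0 (subst (_≤ 0) (ℕP.+-comm λ' 1) λ'+1≤0))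
proposition7 k d λ' (suc J) a r 1≤k _ _ λ'≤d _ _ j≤m+2 r<j big small t t↑ =
  plane , meets , vertex , strictMono⇒injective vertex↑ , vertex∈plane
  where
  m : ℕ
  m = d ∸ λ'
  L : Layout (Fin ((m + 1) + a * suc J + r))
  L = layout a r J (allFin ((m + 1) + a * suc J + r))
  J≤m+1 : J ≤ suc m
  J≤m+1 = ℕP.≤-pred (subst (suc J ≤_) (ℕP.+-comm m 2) j≤m+2)
  open SeparatorPlane t t↑ L (subst (AllPairs Fin._<_) (sym (flatten-layout a r J _)) (allFin-sorted _))
    (length-separators-layout-allFin a r J m (ℕP.<⇒≤ r<j) J≤m+1) (ℕP.m∸n+n≡m λ'≤d)
  meets : (K : Subset _) → ∣ K ∣ ≡ k → ∃ λ y → y ∈P plane × InConv (cyclicVerts d t) K y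
  meets K |K|≡k with any? (_∈? K) S
  ... | yes hit = let (i , i∈S , i∈K) = find hit in
                  cyclicVerts d t i , All.lookup separator∈plane i∈S , InConv-vertex (cyclicVerts d t) K i∈K
  ... | no miss = plane-meetsHull K S∉K (enough-picks a r J K 1≤k big small |K|≡k S∉K)
    where
    S∉K : All (_∉ K) S
    S∉K = ¬Any⇒All¬ S miss
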